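{- Let $m\ge 1$, $n=2m$, $q=2^m$, $\mathbb{K}=\mathbb{F}_q\subset\mathbb{F}=\mathbb{F}_{q^2}$, and let $k$ be a positive integer. Let $g\in\mathcal{T}_1=\{X\in\mathbb{F}: X+X^q=1\}$. Then: (i) $\mathrm{Tr}(g^{2^k+1})=g^{2^k}+g+1$. (ii) $g^{2^k+1}=\mathrm{Tr}(g^{2^k+1})\,g+\mathrm{Tr}(g^3)+1$. (iii) For integers $d,e>0$: $\gcd(2^d-1,2^e+1)>1$ if and only if $\nu_2(d)>\nu_2(e)$; $\gcd(2^d+1,2^e+1)>1$ if and only if $\nu_2(d)=\nu_2(e)$; and $1\in\{\gcd(2^d-1,2^e+1),\gcd(2^d+1,2^e+1)\}$. (iv) Let $d=\gcd(m,k)$. Then $\mathrm{Tr}_{\mathbb{F}_{2^n}/\mathbb{F}_{2^d}}(g^{2^k+1})=1$ if $\gcd(2^k+1,q+1)=1$ and $=0$ otherwise. Also $\mathrm{Tr}_{\mathbb{F}_{2^n}/\mathbb{F}_2}(g^{2^k+1})=1$ if $m+k$ is odd and $=0$ if $m+k$ is even. (v) For $\epsilon\in\mathbb{F}_2$ let $Z_{k,\epsilon}=\{g\in\mathcal{T}_1: g^{2^k}+g=\epsilon\}$. Then $\phi(Z_{k,0})\cup\{1\}$ is the set of $\gcd(2^k-1,q+1)$-th roots of unity in $\mathcal{P}_{q-1}$; $\phi(Z_{k,1})\cup\{1\}$ is the set of $\gcd(2^k+1,q+1)$-th roots of unity in $\mathcal{P}_{q-1}$; $\#Z_{k,0}=\gcd(2^k-1,q+1)-1$;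 and $\#Z_{k,1}=\gcd(2^k+1,q+1)-1$. (vi) If $\gcd(k,n)=1$, then $\mathrm{Tr}(g^{2^k+1})=0$ if and only if $m$ is odd and $g\in\mathbb{F}_4\setminus\mathbb{F}_2$.
   Context: $\mathrm{Tr}(X)=X+X^q$ denotes the relative trace $\mathbb{F}\to\mathbb{K}$; for $d\mid e$, $\mathrm{Tr}_{\mathbb{F}_{2^e}/\mathbb{F}_{2^d}}(X)=\sum_{i=0}^{e/d-1}X^{2^{id}}$. $\nu_2(k)$ denotes the largest integer $e\ge 0$ with $2^e\mid k$. $\mathcal{P}_{q-1}=\{X^{q-1}:X\in\mathbb{F}^*\}$ is the cyclic subgroup of $\mathbb{F}^*$ of order $q+1$, and $\phi:\mathbb{F}\to\mathcal{P}_{q-1}$ is $\phi(X)=X^{q-1}$. -}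

module Defs where

open import Level using (0ℓ)
open import Algebra.Bundles using (CommutativeRing; Semiring)
import Algebra.Definitions.RawSemiring as RawSemiringDefs
open import Data.Nat as ℕ using (ℕ; zero; suc)
open import Data.Fin using (Fin)
open import Data.List using (List; length; filter; map)
open import Data.List using () renaming (allFin to allFinL)
open import Data.Product using (∃; _×_)
open import Relation.Nullary using (¬_; Dec)
open import Relation.Binary.Definitions using (Decidable)
open import Relation.Binary.PropositionalEquality using (_≡_)

-- Since any two finite fields of the same order are isomorphic, quantifying
-- over all such records is the same as speaking about 𝔽_{2^n}.
record GF2^ (n : ℕ) : Set₁ where
  field
    commRing : CommutativeRing 0ℓ 0ℓ
  open CommutativeRing commRing public
  open RawSemiringDefs (Semiring.rawSemiring (CommutativeRing.semiring commRing)) public using (_^_)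
  field
    _≟_       : Decidable _≈_
    1≉0       : ¬ (1# ≈ 0#)
    inverse   : ∀ x → ¬ (x ≈ 0#) → ∃ λ y → x * y ≈ 1#
    char2     : 1# + 1# ≈ 0#
    enum      : Fin (2 ℕ.^ n) → Carrier
    enum-inj  : ∀ i j → enum i ≈ enum j → i ≡ j
    enum-surj : ∀ x → ∃ λ i → enum i ≈ x

module FieldDefs {n : ℕ} (F : GF2^ n) where
  open GF2^ F

  -- Σ_{i < t} X^(2^(i·d));  for d ∣ n and t = n / d this is
  -- Tr_{𝔽_{2^n}/𝔽_{2^d}}(X).
  relTrace : (d t : ℕ) → Carrier → Carrier
  relTrace d zero    X = 0#
  relTrace d (suc t) X = relTrace d t X + X ^ (2 ℕ.^ (t ℕ.* d))

  count : (P : Carrier → Set) → (∀ x → Dec (P x)) → ℕ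
  count P P? = length (filter (λ i → P? (enum i)) (allFinL (2 ℕ.^ n)))

open import Data.Nat.Divisibility using (_∣_)
IsNu2 : ℕ → ℕ → Set
IsNu2 k e = (2 ℕ.^ e) ∣ k × (∀ e′ → (2 ℕ.^ e′) ∣ k → e′ ℕ.≤ e)

module Submission where

open import Defs
open import Data.Nat as ℕ using (ℕ; zero; suc; _∸_; _%_; _<_; _≤_)
import Data.Nat.Properties as ℕP
open import Data.Nat.GCD using (gcd)
open import Data.Product using (_×_; ∃; _,_; proj₁; proj₂)
open import Data.Sum using (_⊎_; inj₁; inj₂)
open import Data.Empty using (⊥-elim)
open import Relation.Nullary using (¬_; yes; no)
open import Relation.Nullary.Decidable using (_×-dec_)
open import Relation.Binary.PropositionalEquality using (_≡_)
import Relation.Binary.PropositionalEquality as P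

-- Everything rests on g^q = g + 1 for g ∈ 𝒯₁.  Raising it to the power 2^k + 1 gives the
-- trace formula (i), and (ii) is algebra on top of (i).  For (iv) the trace down to 𝔽_{2^d},
-- d = gcd(m,k), folds into conjugates of (i) and telescopes to (k/d + m/d)·1, while
-- gcd(2^k+1, 2^m+1) = 1 exactly when k/d + m/d is odd.  That fact and (iii) come from three
-- divisibilities: 2^c + 1 divides 2^(c·odd) + 1 and 2^(2c·t) − 1, and 2^L ± 1 are coprime.
-- For (vi), a vanishing trace makes g fixed by x ↦ x^(4^k) and x ↦ x^(4^m), hence by x ↦ x^4.
-- For (v), φ(g) = g^(q−1) maps 𝒯₁ bijectively onto the (q+1)-th roots of unity y ≠ 1 (inverse
-- y ↦ 1/(y+1)) and turns g^(2^k) = g + ε into y^(2^k ∓ 1) = 1; counting uses that x^N = 1 has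
-- exactly N solutions for N ∣ 2^n − 1 (Fermat's little theorem and the polynomial root bound).

module PowersOfTwo where

  open import Data.Nat
  open import Data.Nat.Properties
  open import Data.Nat.Divisibility
  open import Data.Nat.DivMod using ([m+kn]%n≡m%n)
  open import Data.Nat.GCD using (gcd[m,n]∣m; gcd[m,n]∣n; gcd-greatest; gcd-comm; gcd[m,n]≢0; module GCD; gcd-GCD; module Bézout)
  open import Data.Empty using (⊥)
  open import Relation.Binary.PropositionalEquality
  open import Relation.Binary.Definitions using (tri<; tri≈; tri>)
  open import Data.Nat.Tactic.RingSolver using (solve-∀)

  even-or-odd : ∀ t → (∃ λ s → t ≡ 2 * s) ⊎ (∃ λ s → t ≡ 1 + 2 * s)
  even-or-odd zero = inj₁ (0 , refl)
  even-or-odd (suc t) with even-or-odd t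
  ... | inj₁ (s , refl) = inj₂ (s , refl)
  ... | inj₂ (s , refl) = inj₁ (suc s , cong suc (sym (+-suc s (s + 0))))

  even-%2 : ∀ s → (2 * s) % 2 ≡ 0
  even-%2 s = trans (cong (_% 2) (*-comm 2 s)) ([m+kn]%n≡m%n 0 s 2)

  odd-%2 : ∀ s → (1 + 2 * s) % 2 ≡ 1
  odd-%2 s = trans (cong (λ z → (1 + z) % 2) (*-comm 2 s)) ([m+kn]%n≡m%n 1 s 2)

  mersenne : ℕ → ℕ
  mersenne a = 2 ^ a ∸ 1

  2^≡1+mersenne : ∀ a → 2 ^ a ≡ 1 + mersenne a
  2^≡1+mersenne a = sym (m+[n∸m]≡n (m^n>0 2 a))

  mersenne-+ : ∀ a b → mersenne (a + b) ≡ mersenne a * 2 ^ b + mersenne b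
  mersenne-+ a b = suc-injective (begin
      1 + mersenne (a + b)                        ≡⟨ sym (2^≡1+mersenne (a + b)) ⟩
      2 ^ (a + b)                                 ≡⟨ ^-distribˡ-+-* 2 a b ⟩
      2 ^ a * 2 ^ b                               ≡⟨ cong₂ _*_ (2^≡1+mersenne a) (2^≡1+mersenne b) ⟩
      (1 + mersenne a) * (1 + mersenne b)         ≡⟨ expand (mersenne a) (mersenne b) ⟩
      1 + (mersenne a * (1 + mersenne b) + mersenne b)
                                                  ≡⟨ cong (λ z → 1 + (mersenne a * z + mersenne b)) (sym (2^≡1+mersenne b)) ⟩
      1 + (mersenne a * 2 ^ b + mersenne b)       ∎)
    where
    open ≡-Reasoning
    expand : ∀ x y → (1 + x) * (1 + y) ≡ 1 + (x * (1 + y) + y)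
    expand = solve-∀

  mersenne-∣-multiple : ∀ a t → mersenne a ∣ mersenne (a * t)
  mersenne-∣-multiple a zero rewrite *-zeroʳ a = _ ∣0
  mersenne-∣-multiple a (suc t) rewrite *-suc a t | mersenne-+ a (a * t) =
    ∣m∣n⇒∣m+n (∣m⇒∣m*n (2 ^ (a * t)) ∣-refl) (mersenne-∣-multiple a t)

  mersenne-∣ : ∀ {a b} → a ∣ b → mersenne a ∣ mersenne b
  mersenne-∣ {a} (divides t refl) = subst (λ z → mersenne a ∣ mersenne z) (*-comm a t) (mersenne-∣-multiple a t)

  -- x + 1 ∣ x^(2s+1) + 1  (x ≡ −1 modulo x + 1); by induction on s, with X = x^(2s+1):
  -- X·(x + 1) + (x^(2s+3) + 1) = x·X·(x + 1) + (X + 1)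
  1+∣odd-power+1 : ∀ x s → x + 1 ∣ x ^ (1 + 2 * s) + 1
  1+∣odd-power+1 x zero rewrite *-identityʳ x = ∣-refl
  1+∣odd-power+1 x (suc s) = ∣m+n∣m⇒∣n sum-divisible (n∣m*n X)
    where
    X : ℕ
    X = x ^ (1 + 2 * s)
    exponent : 1 + 2 * suc s ≡ suc (suc (1 + 2 * s))
    exponent = cong suc (*-suc 2 s)
    regroup : ∀ x X → X * (x + 1) + (x * (x * X) + 1) ≡ (x * X) * (x + 1) + (X + 1)
    regroup = solve-∀
    sum-divisible : x + 1 ∣ X * (x + 1) + (x ^ (1 + 2 * suc s) + 1)
    sum-divisible =
      subst (λ z → x + 1 ∣ X * (x + 1) + (x ^ z + 1)) (sym exponent)
        (subst (x + 1 ∣_) (sym (regroup x X)) (∣m∣n⇒∣m+n (n∣m*n (x * X)) (1+∣odd-power+1 x s)))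

  2^+1-∣-odd-multiple : ∀ a s → 2 ^ a + 1 ∣ 2 ^ (a * (1 + 2 * s)) + 1
  2^+1-∣-odd-multiple a s rewrite sym (^-*-assoc 2 a (1 + 2 * s)) = 1+∣odd-power+1 (2 ^ a) s

  -- 2^a + 1 ∣ 2^b − 1 whenever 2a ∣ b, since 2^(2a) − 1 = (2^a − 1)(2^a + 1)
  2^+1-∣-mersenne : ∀ {a b} → 2 * a ∣ b → 2 ^ a + 1 ∣ mersenne b
  2^+1-∣-mersenne {a} 2a∣b = ∣-trans (subst (2 ^ a + 1 ∣_) (sym factor) (n∣m*n (mersenne a))) (mersenne-∣ 2a∣b)
    where
    distrib : ∀ y z → y * (z + 1) ≡ y * z + y
    distrib = solve-∀
    factor : mersenne (2 * a) ≡ mersenne a * (2 ^ a + 1)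
    factor = trans (cong (λ z → mersenne (a + z)) (+-identityʳ a))
                   (trans (mersenne-+ a a) (sym (distrib (mersenne a) (2 ^ a))))

  -- a common divisor of 2^L − 1 and 2^L + 1 divides their difference 2, but 2^L + 1 is odd
  common-divisor≡1 : ∀ L G → 1 ≤ L → G ∣ mersenne L → G ∣ 2 ^ L + 1 → G ≡ 1
  common-divisor≡1 L G 1≤L G∣M G∣P with divisor-of-2 (∣m+n∣m⇒∣n G∣M+2 G∣M)
    where
    divisor-of-2 : ∀ {G} → G ∣ 2 → G ≡ 1 ⊎ G ≡ 2
    divisor-of-2 {zero} p with () ← 0∣⇒≡0 p
    divisor-of-2 {suc zero} p = inj₁ refl
    divisor-of-2 {suc (suc zero)} p = inj₂ refl
    divisor-of-2 {suc (suc (suc G))} p with s≤s (s≤s ()) ← ∣⇒≤ p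
    shift : ∀ y → 1 + y + 1 ≡ y + 2
    shift = solve-∀
    G∣M+2 : G ∣ mersenne L + 2
    G∣M+2 = subst (G ∣_) (trans (cong (_+ 1) (2^≡1+mersenne L)) (shift (mersenne L))) G∣P
  ... | inj₁ G≡1 = G≡1
  ... | inj₂ refl = ⊥-elim (2∤1 (∣m+n∣m⇒∣n G∣P (2∣2^ L 1≤L)))
    where
    2∤1 : ¬ (2 ∣ 1)
    2∤1 p with s≤s () ← ∣⇒≤ p
    2∣2^ : ∀ L → 1 ≤ L → 2 ∣ 2 ^ L
    2∣2^ (suc L) _ = m∣m*n (2 ^ L)

  gcd≡1-through : ∀ {A B} L → 1 ≤ L → A ∣ mersenne L → B ∣ 2 ^ L + 1 → gcd A B ≡ 1
  gcd≡1-through {A} {B} L 1≤L A∣ B∣ =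
    common-divisor≡1 L (gcd A B) 1≤L (∣-trans (gcd[m,n]∣m A B) A∣) (∣-trans (gcd[m,n]∣n A B) B∣)

  1<gcd-through : ∀ {X A B} → X ∣ A → X ∣ B → 1 < X → 1 ≤ B → 1 < gcd A B
  1<gcd-through {X} {A} {B} X∣A X∣B 1<X 1≤B = <-≤-trans 1<X (∣⇒≤ ⦃ gcd-nonZero ⦄ (gcd-greatest X∣A X∣B))
    where
    gcd-nonZero : NonZero (gcd A B)
    gcd-nonZero = ≢-nonZero (gcd[m,n]≢0 A B (inj₂ λ B≡0 → <-irrefl (sym B≡0) 1≤B))

  1<2^+1 : ∀ c → 1 < 2 ^ c + 1
  1<2^+1 c = +-monoˡ-≤ 1 (m^n>0 2 c)

  -- gcd(2^(c(2a+1)) − 1, 2^(cb) + 1) = 1, through L = cb(2a+1)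
  gcd-mersenne-odd : ∀ c a b → 1 ≤ c * b → gcd (mersenne (c * (1 + 2 * a))) (2 ^ (c * b) + 1) ≡ 1
  gcd-mersenne-odd c a b 1≤cb =
    gcd≡1-through (c * b * (1 + 2 * a)) (*-mono-≤ 1≤cb (s≤s z≤n))
      (mersenne-∣ (divides b (rearrange c a b))) (2^+1-∣-odd-multiple (c * b) a)
    where
    rearrange : ∀ c a b → c * b * (1 + 2 * a) ≡ b * (c * (1 + 2 * a))
    rearrange = solve-∀

  -- 2^c + 1 divides both 2^(2ca) − 1 and 2^(c(2b+1)) + 1
  gcd-mersenne-even : ∀ c a b → 1 < gcd (mersenne (2 * c * a)) (2 ^ (c * (1 + 2 * b)) + 1)
  gcd-mersenne-even c a b =
    1<gcd-through (2^+1-∣-mersenne {c} (divides a (*-comm (2 * c) a))) (2^+1-∣-odd-multiple c b)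
      (1<2^+1 c) (<⇒≤ (1<2^+1 (c * (1 + 2 * b))))

  -- 2^c + 1 divides both 2^(c(2a+1)) + 1 and 2^(c(2b+1)) + 1
  gcd-plus-odd-odd : ∀ c a b → 1 < gcd (2 ^ (c * (1 + 2 * a)) + 1) (2 ^ (c * (1 + 2 * b)) + 1)
  gcd-plus-odd-odd c a b =
    1<gcd-through (2^+1-∣-odd-multiple c a) (2^+1-∣-odd-multiple c b)
      (1<2^+1 c) (<⇒≤ (1<2^+1 (c * (1 + 2 * b))))

  -- gcd(2^(c(2a+1)) + 1, 2^(2cb) + 1) = 1, through L = 2cb(2a+1)
  gcd-plus-odd-even : ∀ c a b → 1 ≤ 2 * c * b → gcd (2 ^ (c * (1 + 2 * a)) + 1) (2 ^ (2 * c * b) + 1) ≡ 1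
  gcd-plus-odd-even c a b 1≤2cb =
    gcd≡1-through (2 * c * b * (1 + 2 * a)) (*-mono-≤ 1≤2cb (s≤s z≤n))
      (2^+1-∣-mersenne {c * (1 + 2 * a)} (divides b (rearrange c a b))) (2^+1-∣-odd-multiple (2 * c * b) a)
    where
    rearrange : ∀ c a b → 2 * c * b * (1 + 2 * a) ≡ b * (2 * (c * (1 + 2 * a)))
    rearrange = solve-∀

  odd-part : ∀ {d u} → IsNu2 d u → ∃ λ s → d ≡ 2 ^ u * (1 + 2 * s)
  odd-part {d} {u} (divides r d≡r2^u , maximal) with even-or-odd r
  ... | inj₂ (s , refl) = s , trans d≡r2^u (*-comm (1 + 2 * s) (2 ^ u))
  ... | inj₁ (s , refl) = ⊥-elim (<-irrefl refl (maximal (suc u) (divides s (trans d≡r2^u (regroup s (2 ^ u))))))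
    where
    regroup : ∀ s x → 2 * s * x ≡ s * (2 * x)
    regroup = solve-∀

  2^+-split : ∀ u w x → 2 ^ (u + w) * x ≡ 2 ^ u * (2 ^ w * x)
  2^+-split u w x = trans (cong (_* x) (^-distribˡ-+-* 2 u w)) (*-assoc (2 ^ u) (2 ^ w) x)

  2^suc+-split : ∀ u w x → 2 ^ suc (u + w) * x ≡ 2 * 2 ^ u * (2 ^ w * x)
  2^suc+-split u w x =
    trans (*-assoc 2 (2 ^ (u + w)) x) (trans (cong (2 *_) (2^+-split u w x)) (sym (*-assoc 2 (2 ^ u) _)))

  -- u ≤ v: gcd(2^d − 1, 2^e + 1) = 1, as e = 2^u·b
  gcd-mersenne-≤ : ∀ u s v t → u ≤ v → 1 ≤ 2 ^ v * (1 + 2 * t) →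
    gcd (mersenne (2 ^ u * (1 + 2 * s))) (2 ^ (2 ^ v * (1 + 2 * t)) + 1) ≡ 1
  gcd-mersenne-≤ u s v t u≤v 1≤e with w , refl ← m≤n⇒∃[o]m+o≡n u≤v =
    subst (λ z → gcd (mersenne (2 ^ u * (1 + 2 * s))) (2 ^ z + 1) ≡ 1) (sym e≡)
      (gcd-mersenne-odd (2 ^ u) s (2 ^ w * (1 + 2 * t)) (subst (1 ≤_) e≡ 1≤e))
    where
    e≡ : 2 ^ (u + w) * (1 + 2 * t) ≡ 2 ^ u * (2 ^ w * (1 + 2 * t))
    e≡ = 2^+-split u w (1 + 2 * t)

  -- v < u: 2^(2^v) + 1 divides both, as d = 2·2^v·a
  gcd-mersenne-> : ∀ u s v t → v < u →
    1 < gcd (mersenne (2 ^ u * (1 + 2 * s))) (2 ^ (2 ^ v * (1 + 2 * t)) + 1)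
  gcd-mersenne-> u s v t v<u with w , refl ← m≤n⇒∃[o]m+o≡n v<u =
    subst (λ z → 1 < gcd (mersenne z) (2 ^ (2 ^ v * (1 + 2 * t)) + 1)) (sym (2^suc+-split v w (1 + 2 * s)))
      (gcd-mersenne-even (2 ^ v) (2 ^ w * (1 + 2 * s)) t)

  -- u = v: 2^(2^u) + 1 divides both
  gcd-plus-≡ : ∀ u s t → 1 < gcd (2 ^ (2 ^ u * (1 + 2 * s)) + 1) (2 ^ (2 ^ u * (1 + 2 * t)) + 1)
  gcd-plus-≡ u = gcd-plus-odd-odd (2 ^ u)

  -- u < v (and symmetrically v < u): gcd(2^d + 1, 2^e + 1) = 1, as e = 2·2^u·b
  gcd-plus-< : ∀ u s v t → u < v → 1 ≤ 2 ^ v * (1 + 2 * t) →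
    gcd (2 ^ (2 ^ u * (1 + 2 * s)) + 1) (2 ^ (2 ^ v * (1 + 2 * t)) + 1) ≡ 1
  gcd-plus-< u s v t u<v 1≤e with w , refl ← m≤n⇒∃[o]m+o≡n u<v =
    subst (λ z → gcd (2 ^ (2 ^ u * (1 + 2 * s)) + 1) (2 ^ z + 1) ≡ 1) (sym e≡)
      (gcd-plus-odd-even (2 ^ u) s (2 ^ w * (1 + 2 * t)) (subst (1 ≤_) e≡ 1≤e))
    where
    e≡ : 2 ^ suc (u + w) * (1 + 2 * t) ≡ 2 * 2 ^ u * (2 ^ w * (1 + 2 * t))
    e≡ = 2^suc+-split u w (1 + 2 * t)

  gcd-plus-> : ∀ u s v t → v < u → 1 ≤ 2 ^ u * (1 + 2 * s) →
    gcd (2 ^ (2 ^ u * (1 + 2 * s)) + 1) (2 ^ (2 ^ v * (1 + 2 * t)) + 1) ≡ 1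
  gcd-plus-> u s v t v<u 1≤d =
    trans (gcd-comm (2 ^ (2 ^ u * (1 + 2 * s)) + 1) _) (gcd-plus-< v t u s v<u 1≤d)

  part-iii : ∀ d e u v → 1 ≤ d → 1 ≤ e → IsNu2 d u → IsNu2 e v →
      ((1 < gcd (mersenne d) (2 ^ e + 1) → v < u) × (v < u → 1 < gcd (mersenne d) (2 ^ e + 1)))
    × ((1 < gcd (2 ^ d + 1) (2 ^ e + 1) → u ≡ v) × (u ≡ v → 1 < gcd (2 ^ d + 1) (2 ^ e + 1)))
    × (gcd (mersenne d) (2 ^ e + 1) ≡ 1 ⊎ gcd (2 ^ d + 1) (2 ^ e + 1) ≡ 1)
  part-iii d e u v 1≤d 1≤e νd νe with s , refl ← odd-part νd | t , refl ← odd-part νe =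
    (mersenne-shared , gcd-mersenne-> u s v t) , (plus-shared , λ { refl → gcd-plus-≡ u s t }) , one-coprime
    where
    not-both : ∀ {g} → g ≡ 1 → ¬ (1 < g)
    not-both refl = <-irrefl refl
    mersenne-shared : 1 < gcd (mersenne (2 ^ u * (1 + 2 * s))) (2 ^ (2 ^ v * (1 + 2 * t)) + 1) → v < u
    mersenne-shared 1<g with <-cmp v u
    ... | tri< v<u _ _ = v<u
    ... | tri≈ _ refl _ = ⊥-elim (not-both (gcd-mersenne-≤ u s v t ≤-refl 1≤e) 1<g)
    ... | tri> _ _ u<v = ⊥-elim (not-both (gcd-mersenne-≤ u s v t (<⇒≤ u<v) 1≤e) 1<g)
    plus-shared : 1 < gcd (2 ^ (2 ^ u * (1 + 2 * s)) + 1) (2 ^ (2 ^ v * (1 + 2 * t)) + 1) → u ≡ v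
    plus-shared 1<g with <-cmp u v
    ... | tri< u<v _ _ = ⊥-elim (not-both (gcd-plus-< u s v t u<v 1≤e) 1<g)
    ... | tri≈ _ u≡v _ = u≡v
    ... | tri> _ _ v<u = ⊥-elim (not-both (gcd-plus-> u s v t v<u 1≤d) 1<g)
    one-coprime : gcd (mersenne (2 ^ u * (1 + 2 * s))) (2 ^ (2 ^ v * (1 + 2 * t)) + 1) ≡ 1
                ⊎ gcd (2 ^ (2 ^ u * (1 + 2 * s)) + 1) (2 ^ (2 ^ v * (1 + 2 * t)) + 1) ≡ 1
    one-coprime with ≤-<-connex u v
    ... | inj₁ u≤v = inj₁ (gcd-mersenne-≤ u s v t u≤v 1≤e)
    ... | inj₂ v<u = inj₂ (gcd-plus-> u s v t v<u 1≤d)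

  -- For d = gcd(m,k), the cofactors m/d and k/d are not both even:
  -- otherwise 2d would be a common divisor larger than the greatest one.
  cofactors-not-both-even : ∀ m k s k′ → 1 ≤ m → m ≡ s * gcd m k → k ≡ k′ * gcd m k →
    (∃ λ a → k′ ≡ 2 * a) → (∃ λ b → s ≡ 2 * b) → ⊥
  cofactors-not-both-even m k s k′ 1≤m m≡ k≡ (a , refl) (b , refl) = <-irrefl refl d<d
    where
    d : ℕ
    d = gcd m k
    instance
      d-nonZero : NonZero d
      d-nonZero = ≢-nonZero (gcd[m,n]≢0 m k (inj₁ λ m≡0 → <-irrefl (sym m≡0) 1≤m))
    regroup : ∀ a d → 2 * a * d ≡ a * (2 * d)
    regroup = solve-∀
    2d∣d : 2 * d ∣ d
    2d∣d = gcd-greatest (divides b (trans m≡ (regroup b d))) (divides a (trans k≡ (regroup a d)))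
    d<d : d < d
    d<d = <-≤-trans (m<n+m d (>-nonZero⁻¹ d)) (subst (_≤ d) (cong (d +_) (+-identityʳ d)) (∣⇒≤ 2d∣d))

  odd-even-coprime : ∀ c a b → 1 ≤ 2 * b * c → gcd (2 ^ ((1 + 2 * a) * c) + 1) (2 ^ (2 * b * c) + 1) ≡ 1
  odd-even-coprime c a b 1≤2bc =
    subst₂ (λ p q → gcd (2 ^ p + 1) (2 ^ q + 1) ≡ 1) (*-comm c (1 + 2 * a)) (swap c b)
      (gcd-plus-odd-even c a b (subst (1 ≤_) (sym (swap c b)) 1≤2bc))
    where
    swap : ∀ c b → 2 * c * b ≡ 2 * b * c
    swap = solve-∀

  gcd-plus-by-parity : ∀ c x y → 1 ≤ x * c → 1 ≤ y * c →
    ((∃ λ a → x ≡ 2 * a) → (∃ λ b → y ≡ 2 * b) → ⊥) →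
      ((x + y) % 2 ≡ 1 × gcd (2 ^ (x * c) + 1) (2 ^ (y * c) + 1) ≡ 1)
    ⊎ ((x + y) % 2 ≡ 0 × 1 < gcd (2 ^ (x * c) + 1) (2 ^ (y * c) + 1))
  gcd-plus-by-parity c x y 1≤xc 1≤yc not-both-even with even-or-odd x | even-or-odd y
  ... | inj₁ x-even | inj₁ y-even = ⊥-elim (not-both-even x-even y-even)
  ... | inj₂ (a , refl) | inj₂ (b , refl) =
    inj₂ ( subst (λ z → z % 2 ≡ 0) (sym (odd+odd a b)) (even-%2 (1 + a + b))
         , subst₂ (λ p q → 1 < gcd (2 ^ p + 1) (2 ^ q + 1)) (*-comm c _) (*-comm c _) (gcd-plus-odd-odd c a b))
    where
    odd+odd : ∀ a b → (1 + 2 * a) + (1 + 2 * b) ≡ 2 * (1 + a + b)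
    odd+odd = solve-∀
  ... | inj₂ (a , refl) | inj₁ (b , refl) =
    inj₁ (subst (λ z → z % 2 ≡ 1) (sym (odd+even a b)) (odd-%2 (a + b)) , odd-even-coprime c a b 1≤yc)
    where
    odd+even : ∀ a b → (1 + 2 * a) + 2 * b ≡ 1 + 2 * (a + b)
    odd+even = solve-∀
  ... | inj₁ (a , refl) | inj₂ (b , refl) =
    inj₁ ( subst (λ z → z % 2 ≡ 1) (sym (even+odd a b)) (odd-%2 (a + b))
         , trans (gcd-comm (2 ^ (2 * a * c) + 1) _) (odd-even-coprime c b a 1≤xc))
    where
    even+odd : ∀ a b → 2 * a + (1 + 2 * b) ≡ 1 + 2 * (a + b)
    even+odd = solve-∀

  multiples-closed : (Q : ℕ → Set) → Q 0 → (∀ a b → Q a → Q b → Q (a + b)) → ∀ c z → Q z → Q (c * z)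
  multiples-closed Q Q0 Q+ zero z _ = Q0
  multiples-closed Q Q0 Q+ (suc c) z Qz = Q+ z (c * z) Qz (multiples-closed Q Q0 Q+ c z Qz)

  -- If it is moreover closed under subtraction, it holds at gcd x y, by Bézout's identity.
  gcd-closed : (Q : ℕ → Set) → Q 0 → (∀ a b → Q a → Q b → Q (a + b)) → (∀ a b → Q (a + b) → Q b → Q a) →
    ∀ x y → Q x → Q y → Q (gcd x y)
  gcd-closed Q Q0 Q+ Q- x y Qx Qy with Bézout.lemma x y
  ... | Bézout.result d isGcd identity with refl ← GCD.unique isGcd (gcd-GCD x y) = from-identity identity
    where
    multiple : ∀ c z → Q z → Q (c * z)
    multiple = multiples-closed Q Q0 Q+
    from-identity : Bézout.Identity d x y → Q d
    from-identity (Bézout.+- u v eq) = Q- d (v * y) (subst Q (sym eq) (multiple u x Qx)) (multiple v y Qy)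
    from-identity (Bézout.-+ u v eq) = Q- d (u * x) (subst Q (sym eq) (multiple v y Qy)) (multiple u x Qx)

  coprime-to-double : ∀ k m → gcd k (2 * m) ≡ 1 → (∃ λ i → k ≡ 1 + 2 * i) × gcd k m ≡ 1
  coprime-to-double k m coprime = k-odd , ∣1⇒≡1 (subst (gcd k m ∣_) coprime gcd[k,m]∣gcd[k,2m])
    where
    gcd[k,m]∣gcd[k,2m] : gcd k m ∣ gcd k (2 * m)
    gcd[k,m]∣gcd[k,2m] = gcd-greatest (gcd[m,n]∣m k m) (∣n⇒∣m*n 2 (gcd[m,n]∣n k m))
    k-odd : ∃ λ i → k ≡ 1 + 2 * i
    k-odd with even-or-odd k
    ... | inj₂ odd = odd
    ... | inj₁ (j , refl) with s≤s () ← ∣⇒≤ (subst (2 ∣_) coprime (gcd-greatest (m∣m*n j) (m∣m*n m)))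

module CharTwoField {n : ℕ} (F : GF2^ n) where
  open GF2^ F public
  open FieldDefs F public
  open import Relation.Binary.Reasoning.Setoid setoid public
  open import Algebra.Properties.CommutativeSemiring.Exp commutativeSemiring public
    using (^-congˡ; ^-congʳ; ^-homo-*; ^-assocʳ; ^-distrib-*)
  open import Data.Maybe using (Maybe; just; nothing)
  open import Algebra.Properties.Semiring.Mult semiring using () renaming (_×_ to _×ₙ_)

  -- Equality of numerals m·1 ≈ n·1 is decided by parity; this is what lets
  -- the natural-coefficient ring solver work modulo 2.
  numeral-mod-2 : ∀ m → (suc (suc m)) ×ₙ 1# ≈ m ×ₙ 1#
  numeral-mod-2 m = begin
    1# + (1# + m ×ₙ 1#) ≈⟨ sym (+-assoc 1# 1# _) ⟩
    (1# + 1#) + m ×ₙ 1# ≈⟨ +-congʳ char2 ⟩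
    0# + m ×ₙ 1#        ≈⟨ +-identityˡ _ ⟩
    m ×ₙ 1#             ∎

  numeral-≟ : ∀ m n → Maybe (m ×ₙ 1# ≈ n ×ₙ 1#)
  numeral-≟ zero zero = just refl
  numeral-≟ zero (suc zero) = nothing
  numeral-≟ (suc zero) zero = nothing
  numeral-≟ (suc zero) (suc zero) = just refl
  numeral-≟ (suc (suc m)) n with numeral-≟ m n
  ... | just p = just (trans (numeral-mod-2 m) p)
  ... | nothing = nothing
  numeral-≟ m (suc (suc n)) with numeral-≟ m n
  ... | just p = just (trans p (sym (numeral-mod-2 n)))
  ... | nothing = nothing

  open import Algebra.Solver.Ring.NaturalCoefficients commutativeSemiring numeral-≟ public
    using (solve; _:=_; _:+_; _:*_; con)

  x+x≈0 : ∀ x → x + x ≈ 0#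
  x+x≈0 = solve 1 (λ x → (x :+ x) := con 0) refl

  +1+1 : ∀ x → x + 1# + 1# ≈ x
  +1+1 x = trans (+-assoc x 1# 1#) (trans (+-congˡ char2) (+-identityʳ x))

  +1-cancel : ∀ x y → x + 1# + (y + 1#) ≈ x + y
  +1-cancel x y = trans (+-assoc x 1# (y + 1#)) (+-congˡ (trans (+-comm 1# (y + 1#)) (+1+1 y)))

  x+[x+1] : ∀ x → x + (x + 1#) ≈ 1#
  x+[x+1] x = trans (sym (+-assoc x x 1#)) (trans (+-congʳ (x+x≈0 x)) (+-identityˡ 1#))

  move : ∀ {a b c} → a + b ≈ c → a ≈ b + c
  move {a} {b} {c} a+b≈c = begin
    a           ≈⟨ solve 2 (λ a b → a := (b :+ (a :+ b))) refl a b ⟩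
    b + (a + b) ≈⟨ +-congˡ a+b≈c ⟩
    b + c       ∎

  sum≈0⇒≈ : ∀ {a b} → a + b ≈ 0# → a ≈ b
  sum≈0⇒≈ {a} {b} a+b≈0 = trans (move a+b≈0) (+-identityʳ b)

  ≈⇒sum≈0 : ∀ {a b} → a ≈ b → a + b ≈ 0#
  ≈⇒sum≈0 {a} {b} a≈b = trans (+-congʳ a≈b) (x+x≈0 b)

  ^1 : ∀ x → x ^ 1 ≈ x
  ^1 x = *-identityʳ x

  ^2 : ∀ x → x ^ 2 ≈ x * x
  ^2 x = *-congˡ (*-identityʳ x)

  ^-+1 : ∀ x e → x ^ (e ℕ.+ 1) ≈ x ^ e * x
  ^-+1 x e = trans (^-homo-* x e 1) (*-congˡ (^1 x))

  1^ : ∀ m → 1# ^ m ≈ 1#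
  1^ zero = refl
  1^ (suc m) = trans (*-identityˡ _) (1^ m)

  0^suc : ∀ m → 0# ^ suc m ≈ 0#
  0^suc m = zeroˡ _

  ^-* : ∀ x a b → x ^ (a ℕ.* b) ≈ (x ^ a) ^ b
  ^-* x a b = sym (^-assocʳ x a b)

  ^-2^suc : ∀ j x → x ^ (2 ℕ.^ suc j) ≈ (x ^ (2 ℕ.^ j)) ^ 2
  ^-2^suc j x = sym (trans (^-assocʳ x (2 ℕ.^ j) 2) (^-congʳ x (ℕP.*-comm (2 ℕ.^ j) 2)))

  frobenius : ∀ j x y → (x + y) ^ (2 ℕ.^ j) ≈ x ^ (2 ℕ.^ j) + y ^ (2 ℕ.^ j)
  frobenius zero x y = trans (^1 (x + y)) (sym (+-cong (^1 x) (^1 y)))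
  frobenius (suc j) x y = begin
    (x + y) ^ (2 ℕ.^ suc j)                    ≈⟨ ^-2^suc j (x + y) ⟩
    ((x + y) ^ (2 ℕ.^ j)) ^ 2                  ≈⟨ ^-congˡ 2 (frobenius j x y) ⟩
    (x ^ (2 ℕ.^ j) + y ^ (2 ℕ.^ j)) ^ 2        ≈⟨ square-of-sum _ _ ⟩
    (x ^ (2 ℕ.^ j)) ^ 2 + (y ^ (2 ℕ.^ j)) ^ 2  ≈⟨ sym (+-cong (^-2^suc j x) (^-2^suc j y)) ⟩
    x ^ (2 ℕ.^ suc j) + y ^ (2 ℕ.^ suc j)      ∎
    where
    square-of-sum : ∀ x y → (x + y) ^ 2 ≈ x ^ 2 + y ^ 2
    square-of-sum x y = begin
      (x + y) ^ 2       ≈⟨ ^2 (x + y) ⟩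
      (x + y) * (x + y) ≈⟨ solve 2 (λ x y → ((x :+ y) :* (x :+ y)) := (x :* x :+ y :* y)) refl x y ⟩
      x * x + y * y     ≈⟨ sym (+-cong (^2 x) (^2 y)) ⟩
      x ^ 2 + y ^ 2     ∎

  frobenius-+1 : ∀ j x → (x + 1#) ^ (2 ℕ.^ j) ≈ x ^ (2 ℕ.^ j) + 1#
  frobenius-+1 j x = trans (frobenius j x 1#) (+-congˡ (1^ (2 ℕ.^ j)))

  inv : ∀ x → ¬ (x ≈ 0#) → Carrier
  inv x x≉0 = proj₁ (inverse x x≉0)

  *-inv : ∀ x x≉0 → x * inv x x≉0 ≈ 1#
  *-inv x x≉0 = proj₂ (inverse x x≉0)

  cancelˡ : ∀ {x a b} → ¬ (x ≈ 0#) → x * a ≈ x * b → a ≈ b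
  cancelˡ {x} {a} {b} x≉0 xa≈xb = begin
    a                     ≈⟨ sym (*-identityˡ a) ⟩
    1# * a                ≈⟨ *-congʳ (sym (trans (*-comm _ _) (*-inv x x≉0))) ⟩
    (inv x x≉0 * x) * a   ≈⟨ *-assoc _ _ _ ⟩
    inv x x≉0 * (x * a)   ≈⟨ *-congˡ xa≈xb ⟩
    inv x x≉0 * (x * b)   ≈⟨ sym (*-assoc _ _ _) ⟩
    (inv x x≉0 * x) * b   ≈⟨ *-congʳ (trans (*-comm _ _) (*-inv x x≉0)) ⟩
    1# * b                ≈⟨ *-identityˡ b ⟩
    b                     ∎

  cancelʳ : ∀ {x a b} → ¬ (x ≈ 0#) → a * x ≈ b * x → a ≈ b
  cancelʳ x≉0 ax≈bx = cancelˡ x≉0 (trans (*-comm _ _) (trans ax≈bx (*-comm _ _)))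

  *-≉0 : ∀ {x y} → ¬ (x ≈ 0#) → ¬ (y ≈ 0#) → ¬ (x * y ≈ 0#)
  *-≉0 {x} {y} x≉0 y≉0 xy≈0 = y≉0 (cancelˡ x≉0 (trans xy≈0 (sym (zeroʳ x))))

  ^-≉0 : ∀ {x} m → ¬ (x ≈ 0#) → ¬ (x ^ m ≈ 0#)
  ^-≉0 zero x≉0 = 1≉0
  ^-≉0 (suc m) x≉0 = *-≉0 x≉0 (^-≉0 m x≉0)

  zero-product : ∀ {x y} → x * y ≈ 0# → x ≈ 0# ⊎ y ≈ 0#
  zero-product {x} {y} xy≈0 with x ≟ 0# | y ≟ 0#
  ... | yes x≈0 | _ = inj₁ x≈0
  ... | no _ | yes y≈0 = inj₂ y≈0
  ... | no x≉0 | no y≉0 = ⊥-elim (*-≉0 x≉0 y≉0 xy≈0)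

module TraceOne {n : ℕ} (F : GF2^ n) (m : ℕ) where
  open CharTwoField F

  q : ℕ
  q = 2 ℕ.^ m

  𝒯₁ : Carrier → Set
  𝒯₁ g = g + g ^ q ≈ 1#

  module _ {g : Carrier} (g∈𝒯₁ : 𝒯₁ g) where
    conjugate : g ^ (2 ℕ.^ m) ≈ g + 1#
    conjugate = move (trans (+-comm _ _) g∈𝒯₁)

    -- (i): Tr(g^(2^k+1)) = g^(2^k) + g + 1, since the conjugate of g^(2^k+1) is (g^(2^k) + 1)(g + 1)
    trace-power : ∀ k → let X = g ^ (2 ℕ.^ k ℕ.+ 1) in X + X ^ (2 ℕ.^ m) ≈ g ^ (2 ℕ.^ k) + g + 1#
    trace-power k = begin
      X + X ^ q                                   ≈⟨ +-cong (^-+1 g (2 ℕ.^ k)) X^q≈ ⟩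
      G * g + (G + 1#) * (g + 1#)                 ≈⟨ solve 2 (λ G g → (G :* g :+ (G :+ con 1) :* (g :+ con 1))
                                                                       := (G :+ g :+ con 1)) refl G g ⟩
      G + g + 1#                                  ∎
      where
      a : ℕ
      a = 2 ℕ.^ k ℕ.+ 1
      X : Carrier
      X = g ^ a
      G : Carrier
      G = g ^ (2 ℕ.^ k)
      X^q≈ : X ^ q ≈ (G + 1#) * (g + 1#)
      X^q≈ = begin
        (g ^ a) ^ q                         ≈⟨ ^-assocʳ g a q ⟩
        g ^ (a ℕ.* q)                       ≈⟨ ^-congʳ g (ℕP.*-comm a q) ⟩
        g ^ (q ℕ.* a)                       ≈⟨ ^-* g q a ⟩
        (g ^ q) ^ a                         ≈⟨ ^-congˡ a conjugate ⟩
        (g + 1#) ^ a                        ≈⟨ ^-+1 (g + 1#) (2 ℕ.^ k) ⟩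
        (g + 1#) ^ (2 ℕ.^ k) * (g + 1#)     ≈⟨ *-congʳ (frobenius-+1 k g) ⟩
        (G + 1#) * (g + 1#)                 ∎

    -- (ii): g^(2^k+1) = Tr(g^(2^k+1))·g + Tr(g^3) + 1, by (i) for k and for 1
    power-via-traces : ∀ k → let X = g ^ (2 ℕ.^ k ℕ.+ 1) in
      X ≈ (X + X ^ (2 ℕ.^ m)) * g + (g ^ 3 + (g ^ 3) ^ (2 ℕ.^ m)) + 1#
    power-via-traces k = sym (begin
      (X + X ^ q) * g + (g ^ 3 + (g ^ 3) ^ q) + 1#  ≈⟨ +-congʳ (+-cong (*-congʳ (trace-power k)) (trace-power 1)) ⟩
      (G + g + 1#) * g + (g ^ 2 + g + 1#) + 1#     ≈⟨ +-congʳ (+-congˡ (+-congʳ (+-congʳ (^2 g)))) ⟩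
      (G + g + 1#) * g + (g * g + g + 1#) + 1#     ≈⟨ solve 2 (λ G g → ((G :+ g :+ con 1) :* g :+ (g :* g :+ g :+ con 1) :+ con 1)
                                                                     := (G :* g)) refl G g ⟩
      G * g                                        ≈⟨ sym (^-+1 g (2 ℕ.^ k)) ⟩
      X                                            ∎)
      where
      X : Carrier
      X = g ^ (2 ℕ.^ k ℕ.+ 1)
      G : Carrier
      G = g ^ (2 ℕ.^ k)

module Sums {n : ℕ} (F : GF2^ n) where
  open CharTwoField F
  open PowersOfTwo using (even-or-odd; even-%2; odd-%2)

  ∑ : ℕ → (ℕ → Carrier) → Carrier
  ∑ zero f = 0#
  ∑ (suc t) f = ∑ t f + f t

  relTrace≡∑ : ∀ d t X → relTrace d t X P.≡ ∑ t (λ i → X ^ (2 ℕ.^ (i ℕ.* d)))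
  relTrace≡∑ d zero X = P.refl
  relTrace≡∑ d (suc t) X = P.cong (_+ X ^ (2 ℕ.^ (t ℕ.* d))) (relTrace≡∑ d t X)

  ∑-cong : ∀ t {f g} → (∀ i → f i ≈ g i) → ∑ t f ≈ ∑ t g
  ∑-cong zero f≈g = refl
  ∑-cong (suc t) f≈g = +-cong (∑-cong t f≈g) (f≈g t)

  ∑-+ : ∀ t f g → ∑ t (λ i → f i + g i) ≈ ∑ t f + ∑ t g
  ∑-+ zero f g = sym (+-identityˡ 0#)
  ∑-+ (suc t) f g = begin
    ∑ t (λ i → f i + g i) + (f t + g t) ≈⟨ +-congʳ (∑-+ t f g) ⟩
    ∑ t f + ∑ t g + (f t + g t)          ≈⟨ solve 4 (λ a b c e → (a :+ b :+ (c :+ e)) := (a :+ c :+ (b :+ e)))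
                                                    refl (∑ t f) (∑ t g) (f t) (g t) ⟩
    ∑ t f + f t + (∑ t g + g t)          ∎

  ∑-split : ∀ t u f → ∑ (t ℕ.+ u) f ≈ ∑ t f + ∑ u (λ i → f (t ℕ.+ i))
  ∑-split t zero f = P.subst (λ z → ∑ z f ≈ ∑ t f + 0#) (P.sym (ℕP.+-identityʳ t)) (sym (+-identityʳ _))
  ∑-split t (suc u) f = P.subst (λ z → ∑ z f ≈ ∑ t f + ∑ (suc u) (λ i → f (t ℕ.+ i))) (P.sym (ℕP.+-suc t u))
    (begin
      ∑ (t ℕ.+ u) f + f (t ℕ.+ u)                   ≈⟨ +-congʳ (∑-split t u f) ⟩
      ∑ t f + ∑ u (λ i → f (t ℕ.+ i)) + f (t ℕ.+ u)  ≈⟨ +-assoc _ _ _ ⟩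
      ∑ t f + (∑ u (λ i → f (t ℕ.+ i)) + f (t ℕ.+ u)) ∎)

  ∑-head : ∀ t f → ∑ (suc t) f ≈ f 0 + ∑ t (λ i → f (suc i))
  ∑-head zero f = trans (+-identityˡ _) (sym (+-identityʳ _))
  ∑-head (suc t) f = begin
    ∑ (suc t) f + f (suc t)                 ≈⟨ +-congʳ (∑-head t f) ⟩
    f 0 + ∑ t (λ i → f (suc i)) + f (suc t)  ≈⟨ +-assoc _ _ _ ⟩
    f 0 + (∑ t (λ i → f (suc i)) + f (suc t)) ∎

  -- t·1, which in characteristic 2 only depends on the parity of t
  ones : ℕ → Carrier
  ones t = ∑ t (λ _ → 1#)

  ones-+ : ∀ a b → ones (a ℕ.+ b) ≈ ones a + ones b
  ones-+ a b = ∑-split a b (λ _ → 1#)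

  ones-double : ∀ s → ones (2 ℕ.* s) ≈ 0#
  ones-double s = begin
    ones (s ℕ.+ (s ℕ.+ 0)) ≈⟨ ones-+ s (s ℕ.+ 0) ⟩
    ones s + ones (s ℕ.+ 0) ≡⟨ P.cong (λ z → ones s + ones z) (ℕP.+-identityʳ s) ⟩
    ones s + ones s        ≈⟨ x+x≈0 _ ⟩
    0#                     ∎

  ones-even : ∀ t → t ℕ.% 2 P.≡ 0 → ones t ≈ 0#
  ones-even t t-even with even-or-odd t
  ... | inj₁ (s , P.refl) = ones-double s
  ... | inj₂ (s , P.refl) with () ← P.trans (P.sym (odd-%2 s)) t-even

  ones-odd : ∀ t → t ℕ.% 2 P.≡ 1 → ones t ≈ 1#
  ones-odd t t-odd with even-or-odd t
  ... | inj₂ (s , P.refl) = trans (+-congʳ (ones-double s)) (+-identityˡ 1#)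
  ... | inj₁ (s , P.refl) with () ← P.trans (P.sym (even-%2 s)) t-odd

-- The relative trace of g^(2^k+1) for g ∈ 𝒯₁: if m = s·d and k = k′·d, then
-- Tr_{𝔽_{2^(2m)}/𝔽_{2^d}}(g^(2^k+1)) = (k′ + s)·1.
-- Writing σ(j) = g^(2^(jd)) for the conjugates of g over 𝔽_{2^d}: the trace folds
-- (via X^q) into Σ_{i<s} Tr(X)^(2^(id)) = Σ_{i<s} (σ(k′+i) + σ(i) + 1), and since
-- σ(j+s) = σ(j) + 1 the window sums S(c) = Σ_{i<s} σ(c+i) satisfy S(c) = S(0) + c·1.
module RelativeTrace {n : ℕ} (F : GF2^ n) where
  open CharTwoField F
  open Sums F

  module _ (m k d s k′ : ℕ) (m≡ : m P.≡ s ℕ.* d) (k≡ : k P.≡ k′ ℕ.* d)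
           {g : Carrier} (g∈𝒯₁ : g + g ^ (2 ℕ.^ m) ≈ 1#) where
    open TraceOne F m using (q; conjugate; trace-power)

    X : Carrier
    X = g ^ (2 ℕ.^ k ℕ.+ 1)
    G : Carrier
    G = g ^ (2 ℕ.^ k)

    σ : ℕ → Carrier
    σ j = g ^ (2 ℕ.^ (j ℕ.* d))

    shift-by-q : ∀ Y j → Y ^ (2 ℕ.^ ((s ℕ.+ j) ℕ.* d)) ≈ (Y ^ q) ^ (2 ℕ.^ (j ℕ.* d))
    shift-by-q Y j = trans (^-congʳ Y exponent) (^-* Y q _)
      where
      exponent : 2 ℕ.^ ((s ℕ.+ j) ℕ.* d) P.≡ q ℕ.* 2 ℕ.^ (j ℕ.* d)
      exponent = P.trans (P.cong (2 ℕ.^_) (P.trans (ℕP.*-distribʳ-+ d s j) (P.cong (ℕ._+ j ℕ.* d) (P.sym m≡))))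
                         (ℕP.^-distribˡ-+-* 2 m (j ℕ.* d))

    fold : relTrace d (s ℕ.+ s) X ≈ ∑ s (λ i → (X + X ^ q) ^ (2 ℕ.^ (i ℕ.* d)))
    fold = begin
      relTrace d (s ℕ.+ s) X                                    ≡⟨ relTrace≡∑ d (s ℕ.+ s) X ⟩
      ∑ (s ℕ.+ s) f                                             ≈⟨ ∑-split s s f ⟩
      ∑ s f + ∑ s (λ i → f (s ℕ.+ i))                           ≈⟨ +-congˡ (∑-cong s (shift-by-q X)) ⟩
      ∑ s f + ∑ s (λ i → (X ^ q) ^ (2 ℕ.^ (i ℕ.* d)))           ≈⟨ sym (∑-+ s f _) ⟩
      ∑ s (λ i → f i + (X ^ q) ^ (2 ℕ.^ (i ℕ.* d)))
                                          ≈⟨ ∑-cong s (λ i → sym (frobenius (i ℕ.* d) X (X ^ q))) ⟩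
      ∑ s (λ i → (X + X ^ q) ^ (2 ℕ.^ (i ℕ.* d)))               ∎
      where
      f : ℕ → Carrier
      f i = X ^ (2 ℕ.^ (i ℕ.* d))

    -- conjugating (i): Tr(X)^(2^(id)) = σ(k′+i) + σ(i) + 1
    conjugate-trace : ∀ i → (X + X ^ q) ^ (2 ℕ.^ (i ℕ.* d)) ≈ σ (k′ ℕ.+ i) + σ i + 1#
    conjugate-trace i = begin
      (X + X ^ q) ^ (2 ℕ.^ (i ℕ.* d))   ≈⟨ ^-congˡ (2 ℕ.^ (i ℕ.* d)) (trace-power g∈𝒯₁ k) ⟩
      (G + g + 1#) ^ (2 ℕ.^ (i ℕ.* d))  ≈⟨ frobenius-+1 (i ℕ.* d) (G + g) ⟩
      (G + g) ^ (2 ℕ.^ (i ℕ.* d)) + 1#  ≈⟨ +-congʳ (frobenius (i ℕ.* d) G g) ⟩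
      G ^ (2 ℕ.^ (i ℕ.* d)) + σ i + 1#  ≈⟨ +-congʳ (+-congʳ (trans (^-assocʳ g (2 ℕ.^ k) _) (^-congʳ g exponent))) ⟩
      σ (k′ ℕ.+ i) + σ i + 1#           ∎
      where
      exponent : 2 ℕ.^ k ℕ.* 2 ℕ.^ (i ℕ.* d) P.≡ 2 ℕ.^ ((k′ ℕ.+ i) ℕ.* d)
      exponent = P.trans (P.sym (ℕP.^-distribˡ-+-* 2 k (i ℕ.* d)))
                   (P.cong (2 ℕ.^_) (P.trans (P.cong (ℕ._+ i ℕ.* d) k≡) (P.sym (ℕP.*-distribʳ-+ d k′ i))))

    -- s steps further along the conjugates of g is one application of x ↦ x^q, i.e. adding 1
    σ-period : ∀ j → σ (j ℕ.+ s) ≈ σ j + 1#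
    σ-period j = begin
      σ (j ℕ.+ s)                    ≡⟨ P.cong σ (ℕP.+-comm j s) ⟩
      σ (s ℕ.+ j)                    ≈⟨ shift-by-q g j ⟩
      (g ^ q) ^ (2 ℕ.^ (j ℕ.* d))    ≈⟨ ^-congˡ (2 ℕ.^ (j ℕ.* d)) (conjugate g∈𝒯₁) ⟩
      (g + 1#) ^ (2 ℕ.^ (j ℕ.* d))   ≈⟨ frobenius-+1 (j ℕ.* d) g ⟩
      σ j + 1#                       ∎

    S : ℕ → Carrier
    S c = ∑ s (λ i → σ (c ℕ.+ i))

    S-suc : ∀ c → S (suc c) ≈ S c + 1#
    S-suc c = begin
      S (suc c)                      ≈⟨ solve 2 (λ A B → B := (A :+ (A :+ B))) refl (σ c) (S (suc c)) ⟩
      σ c + (σ c + S (suc c))        ≈⟨ +-congˡ (sym both-ends) ⟩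
      σ c + (S c + (σ c + 1#))       ≈⟨ solve 2 (λ A B → (B :+ (A :+ (B :+ con 1))) := (A :+ con 1)) refl (S c) (σ c) ⟩
      S c + 1#                       ∎
      where
      -- Σ_{i ≤ s} σ(c+i), peeling off the last term or the first one
      both-ends : S c + (σ c + 1#) ≈ σ c + S (suc c)
      both-ends = begin
        S c + (σ c + 1#)                        ≈⟨ +-congˡ (sym (σ-period c)) ⟩
        S c + σ (c ℕ.+ s)                       ≈⟨ ∑-head s (λ i → σ (c ℕ.+ i)) ⟩
        σ (c ℕ.+ 0) + ∑ s (λ i → σ (c ℕ.+ suc i)) ≈⟨ +-cong (reflexive (P.cong σ (ℕP.+-identityʳ c)))
                                                            (∑-cong s (λ i → reflexive (P.cong σ (ℕP.+-suc c i)))) ⟩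
        σ c + S (suc c)                         ∎

    S-shift : ∀ c → S c ≈ S 0 + ones c
    S-shift zero = sym (+-identityʳ _)
    S-shift (suc c) = begin
      S (suc c)          ≈⟨ S-suc c ⟩
      S c + 1#           ≈⟨ +-congʳ (S-shift c) ⟩
      S 0 + ones c + 1#  ≈⟨ +-assoc _ _ _ ⟩
      S 0 + ones (suc c) ∎

    relative-trace : relTrace d (s ℕ.+ s) X ≈ ones (k′ ℕ.+ s)
    relative-trace = begin
      relTrace d (s ℕ.+ s) X                            ≈⟨ fold ⟩
      ∑ s (λ i → (X + X ^ q) ^ (2 ℕ.^ (i ℕ.* d)))       ≈⟨ ∑-cong s conjugate-trace ⟩
      ∑ s (λ i → σ (k′ ℕ.+ i) + σ i + 1#)               ≈⟨ ∑-+ s _ _ ⟩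
      ∑ s (λ i → σ (k′ ℕ.+ i) + σ i) + ones s           ≈⟨ +-congʳ (∑-+ s _ _) ⟩
      S k′ + S 0 + ones s                               ≈⟨ +-congʳ (+-congʳ (S-shift k′)) ⟩
      S 0 + ones k′ + S 0 + ones s                      ≈⟨ solve 3 (λ a b c → (a :+ b :+ a :+ c) := (b :+ c))
                                                                  refl (S 0) (ones k′) (ones s) ⟩
      ones k′ + ones s                                  ≈⟨ sym (ones-+ k′ s) ⟩
      ones (k′ ℕ.+ s)                                   ∎

module PartIV {n : ℕ} (F : GF2^ n) where
  open CharTwoField F
  open Sums F
  open RelativeTrace F using (relative-trace)
  open import Data.Nat.Divisibility using (divides)
  open import Data.Nat.GCD using (gcd[m,n]∣m; gcd[m,n]∣n; gcd[m,n]≢0)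
  open PowersOfTwo using (gcd-plus-by-parity; cofactors-not-both-even)
  open import Data.Nat.Tactic.RingSolver using (solve-∀)

  module _ (m k : ℕ) (1≤m : 1 ≤ m) (1≤k : 1 ≤ k) {g : Carrier} (g∈𝒯₁ : g + g ^ (2 ℕ.^ m) ≈ 1#) where
    X : Carrier
    X = g ^ (2 ℕ.^ k ℕ.+ 1)
    d : ℕ
    d = gcd m k

    instance
      d-nonZero : ℕ.NonZero d
      d-nonZero = ℕ.≢-nonZero (gcd[m,n]≢0 m k (inj₁ λ m≡0 → ℕP.<-irrefl (P.sym m≡0) 1≤m))

    trace-over-gcd : ∀ t s k′ → t ℕ.* d P.≡ 2 ℕ.* m → m P.≡ s ℕ.* d → k P.≡ k′ ℕ.* d →
      relTrace d t X ≈ ones (k′ ℕ.+ s)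
    trace-over-gcd t s k′ td≡2m m≡ k≡ =
      P.subst (λ z → relTrace d z X ≈ ones (k′ ℕ.+ s)) (P.sym t≡s+s) (relative-trace m k d s k′ m≡ k≡ g∈𝒯₁)
      where
      t≡s+s : t P.≡ s ℕ.+ s
      t≡s+s = ℕP.*-cancelʳ-≡ t (s ℕ.+ s) d (P.trans td≡2m (P.trans (P.cong (2 ℕ.*_) m≡) (double s d)))
        where
        double : ∀ s d → 2 ℕ.* (s ℕ.* d) P.≡ (s ℕ.+ s) ℕ.* d
        double = solve-∀

    gcd-via-cofactors : ∀ s k′ → m P.≡ s ℕ.* d → k P.≡ k′ ℕ.* d →
      gcd (2 ℕ.^ k ℕ.+ 1) (2 ℕ.^ m ℕ.+ 1) P.≡ gcd (2 ℕ.^ (k′ ℕ.* d) ℕ.+ 1) (2 ℕ.^ (s ℕ.* d) ℕ.+ 1)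
    gcd-via-cofactors s k′ m≡ k≡ = P.cong₂ (λ a b → gcd (2 ℕ.^ a ℕ.+ 1) (2 ℕ.^ b ℕ.+ 1)) k≡ m≡

    -- the trace down to 𝔽_{2^d}: both gcd(2^k + 1, 2^m + 1) = 1 and the trace (k′ + s)·1 = 1
    -- are decided by the parity of k′ + s (gcd-plus-by-parity)
    over-gcd : ∀ t → t ℕ.* d P.≡ 2 ℕ.* m →
        (gcd (2 ℕ.^ k ℕ.+ 1) (2 ℕ.^ m ℕ.+ 1) P.≡ 1 → relTrace d t X ≈ 1#)
      × (¬ (gcd (2 ℕ.^ k ℕ.+ 1) (2 ℕ.^ m ℕ.+ 1) P.≡ 1) → relTrace d t X ≈ 0#)
    over-gcd t td≡2m with gcd[m,n]∣m m k | gcd[m,n]∣n m k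
    ... | divides s m≡ | divides k′ k≡
      with gcd-plus-by-parity d k′ s (P.subst (1 ≤_) k≡ 1≤k) (P.subst (1 ≤_) m≡ 1≤m)
                              (cofactors-not-both-even m k s k′ 1≤m m≡ k≡)
    ... | inj₁ (k′+s-odd , coprime) =
          (λ _ → trans (trace-over-gcd t s k′ td≡2m m≡ k≡) (ones-odd (k′ ℕ.+ s) k′+s-odd))
        , (λ not-coprime → ⊥-elim (not-coprime (P.trans (gcd-via-cofactors s k′ m≡ k≡) coprime)))
    ... | inj₂ (k′+s-even , 1<gcd) =
          (λ coprime → ⊥-elim (ℕP.<-irrefl (P.trans (P.sym coprime) (gcd-via-cofactors s k′ m≡ k≡)) 1<gcd))
        , (λ _ → trans (trace-over-gcd t s k′ td≡2m m≡ k≡) (ones-even (k′ ℕ.+ s) k′+s-even))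

    -- the absolute trace: the case d = 1, s = m, k′ = k of relative-trace
    absolute : relTrace 1 (2 ℕ.* m) X ≈ ones (m ℕ.+ k)
    absolute = begin
      relTrace 1 (2 ℕ.* m) X  ≡⟨ P.cong (λ z → relTrace 1 (m ℕ.+ z) X) (ℕP.+-identityʳ m) ⟩
      relTrace 1 (m ℕ.+ m) X  ≈⟨ relative-trace m k 1 m k (P.sym (ℕP.*-identityʳ m)) (P.sym (ℕP.*-identityʳ k))
                                                   g∈𝒯₁ ⟩
      ones (k ℕ.+ m)          ≡⟨ P.cong ones (ℕP.+-comm k m) ⟩
      ones (m ℕ.+ k)          ∎

    absolute-odd : (m ℕ.+ k) % 2 P.≡ 1 → relTrace 1 (2 ℕ.* m) X ≈ 1#
    absolute-odd odd = trans absolute (ones-odd (m ℕ.+ k) odd)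

    absolute-even : (m ℕ.+ k) % 2 P.≡ 0 → relTrace 1 (2 ℕ.* m) X ≈ 0#
    absolute-even even = trans absolute (ones-even (m ℕ.+ k) even)

-- The exponents j for which g is fixed by x ↦ x^(4^j) = x^(2^(2j)): they contain 0 and
-- are closed under sums and differences, hence under multiples and gcd.
module FrobeniusFixed {n : ℕ} (F : GF2^ n) (g : GF2^.Carrier F) where
  open CharTwoField F
  open PowersOfTwo using (multiples-closed; gcd-closed)

  Fixed : ℕ → Set
  Fixed j = g ^ (2 ℕ.^ (2 ℕ.* j)) ≈ g

  4^-+ : ∀ a b → 2 ℕ.^ (2 ℕ.* (a ℕ.+ b)) P.≡ 2 ℕ.^ (2 ℕ.* a) ℕ.* 2 ℕ.^ (2 ℕ.* b)
  4^-+ a b = P.trans (P.cong (2 ℕ.^_) (ℕP.*-distribˡ-+ 2 a b)) (ℕP.^-distribˡ-+-* 2 (2 ℕ.* a) (2 ℕ.* b))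

  fixed-0 : Fixed 0
  fixed-0 = ^1 g

  fixed-+ : ∀ a b → Fixed a → Fixed b → Fixed (a ℕ.+ b)
  fixed-+ a b fixed-a fixed-b = begin
    g ^ (2 ℕ.^ (2 ℕ.* (a ℕ.+ b)))                  ≡⟨ P.cong (g ^_) (4^-+ a b) ⟩
    g ^ (2 ℕ.^ (2 ℕ.* a) ℕ.* 2 ℕ.^ (2 ℕ.* b))      ≈⟨ ^-* g (2 ℕ.^ (2 ℕ.* a)) (2 ℕ.^ (2 ℕ.* b)) ⟩
    (g ^ (2 ℕ.^ (2 ℕ.* a))) ^ (2 ℕ.^ (2 ℕ.* b))    ≈⟨ ^-congˡ (2 ℕ.^ (2 ℕ.* b)) fixed-a ⟩
    g ^ (2 ℕ.^ (2 ℕ.* b))                          ≈⟨ fixed-b ⟩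
    g                                              ∎

  fixed-∸ : ∀ a b → Fixed (a ℕ.+ b) → Fixed b → Fixed a
  fixed-∸ a b fixed-a+b fixed-b = begin
    g ^ (2 ℕ.^ (2 ℕ.* a))                          ≈⟨ sym (^-congˡ (2 ℕ.^ (2 ℕ.* a)) fixed-b) ⟩
    (g ^ (2 ℕ.^ (2 ℕ.* b))) ^ (2 ℕ.^ (2 ℕ.* a))    ≈⟨ sym (^-* g (2 ℕ.^ (2 ℕ.* b)) (2 ℕ.^ (2 ℕ.* a))) ⟩
    g ^ (2 ℕ.^ (2 ℕ.* b) ℕ.* 2 ℕ.^ (2 ℕ.* a))      ≡⟨ P.cong (g ^_) (P.trans (ℕP.*-comm (2 ℕ.^ (2 ℕ.* b)) _)
                                                                              (P.sym (4^-+ a b))) ⟩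
    g ^ (2 ℕ.^ (2 ℕ.* (a ℕ.+ b)))                  ≈⟨ fixed-a+b ⟩
    g                                              ∎

  fixed-multiple : ∀ c j → Fixed j → Fixed (c ℕ.* j)
  fixed-multiple = multiples-closed Fixed fixed-0 fixed-+

  fixed-gcd : ∀ a b → Fixed a → Fixed b → Fixed (gcd a b)
  fixed-gcd = gcd-closed Fixed fixed-0 fixed-+ fixed-∸

  4^-as-square : ∀ j → g ^ (2 ℕ.^ (2 ℕ.* j)) ≈ (g ^ (2 ℕ.^ j)) ^ (2 ℕ.^ j)
  4^-as-square j = trans (^-congʳ g exponent) (^-* g (2 ℕ.^ j) (2 ℕ.^ j))
    where
    exponent : 2 ℕ.^ (2 ℕ.* j) P.≡ 2 ℕ.^ j ℕ.* 2 ℕ.^ j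
    exponent = P.trans (P.cong (λ z → 2 ℕ.^ (j ℕ.+ z)) (ℕP.+-identityʳ j)) (ℕP.^-distribˡ-+-* 2 j j)

  𝔽₂-fixed : g ^ 2 ≈ g → ∀ j → g ^ (2 ℕ.^ j) ≈ g
  𝔽₂-fixed g²≈g zero = ^1 g
  𝔽₂-fixed g²≈g (suc j) = trans (^-2^suc j g) (trans (^-congˡ 2 (𝔽₂-fixed g²≈g j)) g²≈g)

  𝔽₄-odd-power : g ^ 4 ≈ g → ∀ i → g ^ (2 ℕ.^ (1 ℕ.+ 2 ℕ.* i)) ≈ g ^ 2
  𝔽₄-odd-power g⁴≈g i =
    trans (^-2^suc (2 ℕ.* i) g) (^-congˡ 2 (P.subst Fixed (ℕP.*-identityʳ i) (fixed-multiple i 1 g⁴≈g)))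

-- If the trace vanishes then g^(2^k) = g + 1, so g is fixed by x ↦ x^(4^k); it is also
-- fixed by x ↦ x^(4^m) = x^(q²), hence by x ↦ x^(4^gcd(k,m)) = x^4.
module PartVI {n : ℕ} (F : GF2^ n) where
  open CharTwoField F
  open PowersOfTwo using (even-or-odd; even-%2; odd-%2; coprime-to-double)

  module _ (m k : ℕ) {g : Carrier} (g∈𝒯₁ : g + g ^ (2 ℕ.^ m) ≈ 1#) (k⊥2m : gcd k (2 ℕ.* m) P.≡ 1) where
    open TraceOne F m using (q; conjugate; trace-power)
    open FrobeniusFixed F g

    X : Carrier
    X = g ^ (2 ℕ.^ k ℕ.+ 1)
    G : Carrier
    G = g ^ (2 ℕ.^ k)

    -- conjugating twice over 𝔽_q gives back g
    fixed-m : Fixed m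
    fixed-m = begin
      g ^ (2 ℕ.^ (2 ℕ.* m))  ≈⟨ 4^-as-square m ⟩
      (g ^ q) ^ q            ≈⟨ ^-congˡ q (conjugate g∈𝒯₁) ⟩
      (g + 1#) ^ q           ≈⟨ frobenius-+1 m g ⟩
      g ^ q + 1#             ≈⟨ +-congʳ (conjugate g∈𝒯₁) ⟩
      g + 1# + 1#            ≈⟨ +1+1 g ⟩
      g                      ∎

    trace-zero⇒ : X + X ^ q ≈ 0# → (m % 2 P.≡ 1 × g ^ 4 ≈ g × ¬ (g ^ 2 ≈ g))
    trace-zero⇒ trace≈0 = m-odd , g⁴≈g , g∉𝔽₂
      where
      G≈g+1 : G ≈ g + 1#
      G≈g+1 = begin
        G                        ≈⟨ solve 2 (λ G g → G := (G :+ g :+ con 1 :+ (g :+ con 1))) refl G g ⟩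
        G + g + 1# + (g + 1#)    ≈⟨ +-congʳ (trans (sym (trace-power g∈𝒯₁ k)) trace≈0) ⟩
        0# + (g + 1#)            ≈⟨ +-identityˡ _ ⟩
        g + 1#                   ∎
      fixed-k : Fixed k
      fixed-k = begin
        g ^ (2 ℕ.^ (2 ℕ.* k))  ≈⟨ 4^-as-square k ⟩
        G ^ (2 ℕ.^ k)          ≈⟨ ^-congˡ (2 ℕ.^ k) G≈g+1 ⟩
        (g + 1#) ^ (2 ℕ.^ k)   ≈⟨ frobenius-+1 k g ⟩
        G + 1#                 ≈⟨ +-congʳ G≈g+1 ⟩
        g + 1# + 1#            ≈⟨ +1+1 g ⟩
        g                      ∎
      g⁴≈g : g ^ 4 ≈ g
      g⁴≈g = P.subst Fixed (proj₂ (coprime-to-double k m k⊥2m)) (fixed-gcd k m fixed-k fixed-m)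
      g∉𝔽₂ : ¬ (g ^ 2 ≈ g)
      g∉𝔽₂ g²≈g = 1≉0 (begin
        1#              ≈⟨ sym (x+[x+1] g) ⟩
        g + (g + 1#)    ≈⟨ ≈⇒sum≈0 (trans (sym (𝔽₂-fixed g²≈g k)) G≈g+1) ⟩
        0#              ∎)
      -- for even m, g would be fixed by x ↦ x^q, contradicting g^q = g + 1
      m-odd : m % 2 P.≡ 1
      m-odd with even-or-odd m
      ... | inj₂ (i , P.refl) = odd-%2 i
      ... | inj₁ (j , P.refl) = ⊥-elim (1≉0 (begin
            1#                           ≈⟨ sym g∈𝒯₁ ⟩
            g + g ^ (2 ℕ.^ (2 ℕ.* j))    ≈⟨ +-congˡ (P.subst Fixed (ℕP.*-identityʳ j) (fixed-multiple j 1 g⁴≈g)) ⟩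
            g + g                        ≈⟨ x+x≈0 g ⟩
            0#                           ∎))

    -- for odd k and odd m both g^(2^k) and g^q equal g^2
    ⇒trace-zero : (m % 2 P.≡ 1 × g ^ 4 ≈ g × ¬ (g ^ 2 ≈ g)) → X + X ^ q ≈ 0#
    ⇒trace-zero (m-odd , g⁴≈g , _) with proj₁ (coprime-to-double k m k⊥2m) | even-or-odd m
    ... | _ | inj₁ (j , P.refl) with () ← P.trans (P.sym (even-%2 j)) m-odd
    ... | i , P.refl | inj₂ (i′ , P.refl) = begin
      X + X ^ q        ≈⟨ trace-power g∈𝒯₁ k ⟩
      G + g + 1#       ≈⟨ +-congʳ (+-congʳ (𝔽₄-odd-power g⁴≈g i)) ⟩
      g ^ 2 + g + 1#   ≈⟨ +-congʳ (+-comm _ _) ⟩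
      g + g ^ 2 + 1#   ≈⟨ +-congʳ (trans (+-congˡ (sym (𝔽₄-odd-power g⁴≈g i′))) g∈𝒯₁) ⟩
      1# + 1#          ≈⟨ char2 ⟩
      0#               ∎

module Counting {n : ℕ} (F : GF2^ n) where
  open CharTwoField F hiding (zero)
  open import Data.Fin using (Fin; zero; suc)
  open import Data.List using (List; []; _∷_; length; filter; tabulate)
  open import Data.List.Properties using (filter-≐)
  open import Data.List.Relation.Unary.All as All using (All; []; _∷_)
  open import Data.List.Relation.Unary.Any using (here; there)
  import Data.List.Relation.Unary.Any.Properties as Any
  open import Data.List.Relation.Unary.AllPairs using ([]; _∷_)
  import Data.List.Relation.Unary.All.Properties as AllProperties
  import Data.List.Relation.Unary.AllPairs.Properties as AllPairsProperties
  open import Data.List.Membership.Setoid setoid using (_∈_)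
  open import Data.List.Membership.Setoid.Properties using (∈-filter⁺)
  open import Data.List.Relation.Unary.Unique.Setoid setoid using (Unique)
  open import Data.Empty using (⊥)
  open import Relation.Nullary using (Dec)

  remove : ∀ {x} (ys : List Carrier) → x ∈ ys → List Carrier
  remove (y ∷ ys) (here _) = ys
  remove (y ∷ ys) (there x∈ys) = y ∷ remove ys x∈ys

  remove-length : ∀ {x} ys (x∈ys : x ∈ ys) → suc (length (remove ys x∈ys)) P.≡ length ys
  remove-length (y ∷ ys) (here _) = P.refl
  remove-length (y ∷ ys) (there x∈ys) = P.cong suc (remove-length ys x∈ys)

  ∈-remove : ∀ {x x′} ys → x′ ∈ ys → (x∈ys : x ∈ ys) → ¬ x ≈ x′ → x′ ∈ remove ys x∈ys
  ∈-remove (y ∷ ys) (here x′≈y) (here x≈y) x≉x′ = ⊥-elim (x≉x′ (trans x≈y (sym x′≈y)))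
  ∈-remove (y ∷ ys) (here x′≈y) (there _) _ = here x′≈y
  ∈-remove (y ∷ ys) (there x′∈ys) (here _) _ = x′∈ys
  ∈-remove (y ∷ ys) (there x′∈ys) (there x∈ys) x≉x′ = there (∈-remove ys x′∈ys x∈ys x≉x′)

  unique-⊆-length : ∀ xs ys → Unique xs → All (_∈ ys) xs → length xs ℕ.≤ length ys
  unique-⊆-length [] ys _ _ = ℕ.z≤n
  unique-⊆-length (x ∷ xs) ys (x∉xs ∷ xs-unique) (x∈ys ∷ xs⊆ys) =
    P.subst (suc (length xs) ℕ.≤_) (remove-length ys x∈ys)
      (ℕ.s≤s (unique-⊆-length xs (remove ys x∈ys) xs-unique (still-in xs x∉xs xs⊆ys)))
    where
    still-in : ∀ zs → All (λ z → ¬ x ≈ z) zs → All (_∈ ys) zs → All (_∈ remove ys x∈ys) zs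
    still-in [] [] [] = []
    still-in (z ∷ zs) (x≉z ∷ x≉zs) (z∈ys ∷ zs⊆ys) = ∈-remove ys z∈ys x∈ys x≉z ∷ still-in zs x≉zs zs⊆ys

  elements : List Carrier
  elements = tabulate enum

  elements-unique : Unique elements
  elements-unique = AllPairsProperties.tabulate⁺ (λ i≢j e → i≢j (enum-inj _ _ e))

  ∈-elements : ∀ x → x ∈ elements
  ∈-elements x with i , enum-i≈x ← enum-surj x = Any.tabulate⁺ i (sym enum-i≈x)

  count≡ : ∀ {P : Carrier → Set} (P? : ∀ x → Dec (P x)) → count P P? P.≡ length (filter P? elements)
  count≡ P? = reindex (λ i → i)
    where
    reindex : ∀ {K} (f : Fin K → Fin (2 ℕ.^ n)) →
      length (filter (λ i → P? (enum i)) (tabulate f)) P.≡ length (filter P? (tabulate (λ i → enum (f i))))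
    reindex {zero} f = P.refl
    reindex {suc K} f with P? (enum (f zero))
    ... | yes _ = P.cong suc (reindex (λ i → f (suc i)))
    ... | no _ = reindex (λ i → f (suc i))

  module _ {P : Carrier → Set} (P? : ∀ x → Dec (P x)) where
    count-lower : (∀ {x y} → x ≈ y → P x → P y) → ∀ xs → Unique xs → All P xs → length xs ℕ.≤ count P P?
    count-lower P-resp xs xs-unique all-P = P.subst (length xs ℕ.≤_) (P.sym (count≡ P?))
      (unique-⊆-length xs (filter P? elements) xs-unique
        (All.map (λ {x} Px → ∈-filter⁺ setoid P? P-resp (∈-elements x) Px) all-P))

    count-upper : ∀ D → (∀ xs → Unique xs → All P xs → length xs ℕ.≤ D) → count P P? ℕ.≤ D
    count-upper D bound = P.subst (ℕ._≤ D) (P.sym (count≡ P?))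
      (bound _ (AllPairsProperties.filter⁺ P? elements-unique) (AllProperties.all-filter P? elements))

  count-≐ : ∀ {A B : Carrier → Set} (A? : ∀ x → Dec (A x)) (B? : ∀ x → Dec (B x)) →
    (∀ {x} → A x → B x) → (∀ {x} → B x → A x) → count A A? P.≡ count B B?
  count-≐ A? B? A⇒B B⇒A = P.trans (count≡ A?)
    (P.trans (P.cong length (filter-≐ A? B? (A⇒B , B⇒A) elements)) (P.sym (count≡ B?)))

  count-⊎ : ∀ {A B C : Carrier → Set} (A? : ∀ x → Dec (A x)) (B? : ∀ x → Dec (B x)) (C? : ∀ x → Dec (C x)) →
    (∀ x → A x → B x ⊎ C x) → (∀ x → B x → A x) → (∀ x → C x → A x) → (∀ x → B x → C x → ⊥) →
    count A A? P.≡ count B B? ℕ.+ count C C?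
  count-⊎ {A} {B} {C} A? B? C? A⇒B⊎C B⇒A C⇒A disjoint = P.trans (count≡ A?)
    (P.trans (split elements) (P.sym (P.cong₂ ℕ._+_ (count≡ B?) (count≡ C?))))
    where
    split : ∀ xs → length (filter A? xs) P.≡ length (filter B? xs) ℕ.+ length (filter C? xs)
    split [] = P.refl
    split (x ∷ xs) with A? x | B? x | C? x
    ... | _      | yes b | yes c = ⊥-elim (disjoint x b c)
    ... | yes _  | yes _ | no _  = P.cong suc (split xs)
    ... | yes _  | no _  | yes _ = P.trans (P.cong suc (split xs)) (P.sym (ℕP.+-suc (length (filter B? xs)) _))
    ... | yes a  | no ¬b | no ¬c with A⇒B⊎C x a
    ...   | inj₁ b = ⊥-elim (¬b b)
    ...   | inj₂ c = ⊥-elim (¬c c)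
    split (x ∷ xs) | no ¬a | yes b | _ = ⊥-elim (¬a (B⇒A x b))
    split (x ∷ xs) | no ¬a | no _ | yes c = ⊥-elim (¬a (C⇒A x c))
    split (x ∷ xs) | no _ | no _ | no _ = split xs

  count-injection : ∀ {A B : Carrier → Set} (A? : ∀ x → Dec (A x)) (B? : ∀ x → Dec (B x)) →
    (f : ∀ x → A x → Carrier) → (∀ x a → B (f x a)) → (∀ x y a a′ → f x a ≈ f y a′ → x ≈ y) →
    (∀ {x y} → x ≈ y → B x → B y) → count A A? ℕ.≤ count B B?
  count-injection {A} {B} A? B? f f∈B f-inj B-resp = count-upper A? (count B B?) λ xs xs-unique all-A →
    P.subst (ℕ._≤ count B B?) (image-length xs all-A)
      (count-lower B? B-resp (image xs all-A) (image-unique xs all-A xs-unique) (image-⊆ xs all-A))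
    where
    image : ∀ xs → All A xs → List Carrier
    image [] [] = []
    image (x ∷ xs) (a ∷ as) = f x a ∷ image xs as
    image-length : ∀ xs as → length (image xs as) P.≡ length xs
    image-length [] [] = P.refl
    image-length (x ∷ xs) (a ∷ as) = P.cong suc (image-length xs as)
    image-⊆ : ∀ xs as → All B (image xs as)
    image-⊆ [] [] = []
    image-⊆ (x ∷ xs) (a ∷ as) = f∈B x a ∷ image-⊆ xs as
    image-unique : ∀ xs as → Unique xs → Unique (image xs as)
    image-unique [] [] _ = []
    image-unique (x ∷ xs) (a ∷ as) (x∉xs ∷ xs-unique) = fresh xs as x∉xs ∷ image-unique xs as xs-unique
      where
      fresh : ∀ zs bs → All (λ z → ¬ x ≈ z) zs → All (λ y → ¬ f x a ≈ y) (image zs bs)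
      fresh [] [] [] = []
      fresh (z ∷ zs) (b ∷ bs) (x≉z ∷ x≉zs) = (λ e → x≉z (f-inj x z a b e)) ∷ fresh zs bs x≉zs

-- Polynomials as coefficient lists (constant term first) and the bound
-- "a polynomial with L coefficients, the last nonzero, has fewer than L roots".
module Polynomials {n : ℕ} (F : GF2^ n) where
  open CharTwoField F hiding (zero)
  open import Data.List using (List; []; _∷_; length; replicate; _++_)
  open import Data.List.Relation.Unary.All using (All; []; _∷_)
  open import Data.List.Relation.Unary.AllPairs using ([]; _∷_)
  open import Data.List.Relation.Unary.Unique.Setoid setoid using (Unique)
  open import Data.Empty using (⊥)

  eval : List Carrier → Carrier → Carrier
  eval [] x = 0#
  eval (c ∷ cs) x = c + x * eval cs x

  LeadingNonzero : List Carrier → Set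
  LeadingNonzero [] = ⊥
  LeadingNonzero (c ∷ []) = ¬ c ≈ 0#
  LeadingNonzero (c ∷ d ∷ cs) = LeadingNonzero (d ∷ cs)

  quotient : List Carrier → Carrier → List Carrier
  quotient [] r = []
  quotient (c ∷ []) r = []
  quotient (c ∷ d ∷ cs) r = eval (d ∷ cs) r ∷ quotient (d ∷ cs) r

  -- p(x) = (x + r)·q(x) + p(r)   (in characteristic 2, x + r = x − r)
  division : ∀ p r x → eval p x ≈ (x + r) * eval (quotient p r) x + eval p r
  division [] r x = sym (trans (+-congʳ (zeroʳ _)) (+-identityʳ 0#))
  division (c ∷ []) r x =
    solve 3 (λ c x r → (c :+ x :* con 0) := ((x :+ r) :* con 0 :+ (c :+ r :* con 0))) refl c x r
  division (c ∷ d ∷ cs) r x = begin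
    c + x * eval (d ∷ cs) x        ≈⟨ +-congˡ (*-congˡ (division (d ∷ cs) r x)) ⟩
    c + x * ((x + r) * Q + P′)     ≈⟨ solve 5 (λ c x r Q P′ → (c :+ x :* ((x :+ r) :* Q :+ P′))
                                                := ((x :+ r) :* (P′ :+ x :* Q) :+ (c :+ r :* P′))) refl c x r Q P′ ⟩
    (x + r) * (P′ + x * Q) + (c + r * P′) ∎
    where
    Q : Carrier
    Q = eval (quotient (d ∷ cs) r) x
    P′ : Carrier
    P′ = eval (d ∷ cs) r

  quotient-leading : ∀ c d cs r → LeadingNonzero (c ∷ d ∷ cs) → LeadingNonzero (quotient (c ∷ d ∷ cs) r)
  quotient-leading c d [] r d≉0 e = d≉0 (trans (sym (trans (+-congˡ (zeroʳ r)) (+-identityʳ d))) e)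
  quotient-leading c d (e ∷ cs) r lead = quotient-leading d e cs r lead

  quotient-length : ∀ c d cs r → length (quotient (c ∷ d ∷ cs) r) P.≡ suc (length cs)
  quotient-length c d [] r = P.refl
  quotient-length c d (e ∷ cs) r = P.cong suc (quotient-length d e cs r)

  -- distinct roots of a polynomial with nonzero leading coefficient are fewer than its coefficients:
  -- dividing out the first root leaves the others as roots of the quotient
  root-bound : ∀ p → LeadingNonzero p → ∀ rs → Unique rs → All (λ r → eval p r ≈ 0#) rs → length rs ℕ.< length p
  root-bound [] () rs _ _
  root-bound (c ∷ cs) _ [] _ _ = ℕ.s≤s ℕ.z≤n
  root-bound (c ∷ []) c≉0 (r ∷ rs) _ (root ∷ _) =
    ⊥-elim (c≉0 (trans (sym (trans (+-congˡ (zeroʳ r)) (+-identityʳ c))) root))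
  root-bound (c ∷ d ∷ cs) lead (r ∷ rs) (r∉rs ∷ rs-unique) (p[r]≈0 ∷ roots) =
    P.subst (λ z → suc (length rs) ℕ.< suc z) (quotient-length c d cs r)
      (ℕ.s≤s (root-bound (quotient p r) (quotient-leading c d cs r lead) rs rs-unique (quotient-roots rs r∉rs roots)))
    where
    p : List Carrier
    p = c ∷ d ∷ cs
    quotient-roots : ∀ zs → All (λ z → ¬ r ≈ z) zs → All (λ z → eval p z ≈ 0#) zs →
                     All (λ z → eval (quotient p r) z ≈ 0#) zs
    quotient-roots [] [] [] = []
    quotient-roots (z ∷ zs) (r≉z ∷ r≉zs) (p[z]≈0 ∷ p[zs]≈0) = q[z]≈0 ∷ quotient-roots zs r≉zs p[zs]≈0
      where
      product≈0 : (z + r) * eval (quotient p r) z ≈ 0#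
      product≈0 = begin
        (z + r) * eval (quotient p r) z              ≈⟨ sym (+-identityʳ _) ⟩
        (z + r) * eval (quotient p r) z + 0#         ≈⟨ +-congˡ (sym p[r]≈0) ⟩
        (z + r) * eval (quotient p r) z + eval p r   ≈⟨ sym (division p r z) ⟩
        eval p z                                     ≈⟨ p[z]≈0 ⟩
        0#                                           ∎
      q[z]≈0 : eval (quotient p r) z ≈ 0#
      q[z]≈0 with zero-product product≈0
      ... | inj₁ z+r≈0 = ⊥-elim (r≉z (sym (sum≈0⇒≈ z+r≈0)))
      ... | inj₂ q≈0 = q≈0

  shift : ℕ → List Carrier → List Carrier
  shift j p = replicate j 0# ++ p

  shift-eval : ∀ j p x → eval (shift j p) x ≈ x ^ j * eval p x
  shift-eval zero p x = sym (*-identityˡ _)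
  shift-eval (suc j) p x = begin
    0# + x * eval (shift j p) x  ≈⟨ +-identityˡ _ ⟩
    x * eval (shift j p) x       ≈⟨ *-congˡ (shift-eval j p x) ⟩
    x * (x ^ j * eval p x)       ≈⟨ sym (*-assoc _ _ _) ⟩
    x * x ^ j * eval p x         ∎

  shift-leading : ∀ j p → LeadingNonzero p → LeadingNonzero (shift j p)
  shift-leading zero p lead = lead
  shift-leading (suc zero) [] ()
  shift-leading (suc zero) (c ∷ cs) lead = lead
  shift-leading (suc (suc j)) p lead = shift-leading (suc j) p lead

  shift-length : ∀ j p → length (shift j p) P.≡ j ℕ.+ length p
  shift-length zero p = P.refl
  shift-length (suc j) p = P.cong suc (shift-length j p)

  -- 1 + x^N, N = suc N′
  x^N+1 : ℕ → List Carrier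
  x^N+1 N′ = 1# ∷ shift N′ (1# ∷ [])

  x^N+1-eval : ∀ N′ x → eval (x^N+1 N′) x ≈ 1# + x ^ suc N′
  x^N+1-eval N′ x = +-congˡ (begin
    x * eval (shift N′ (1# ∷ [])) x  ≈⟨ *-congˡ (shift-eval N′ (1# ∷ []) x) ⟩
    x * (x ^ N′ * (1# + x * 0#))     ≈⟨ *-congˡ (*-congˡ (trans (+-congˡ (zeroʳ x)) (+-identityʳ 1#))) ⟩
    x * (x ^ N′ * 1#)                ≈⟨ *-congˡ (*-identityʳ _) ⟩
    x ^ suc N′                       ∎)

  x^N+1-leading : ∀ N′ → LeadingNonzero (x^N+1 N′)
  x^N+1-leading zero = 1≉0
  x^N+1-leading (suc N′) = shift-leading (suc N′) (1# ∷ []) 1≉0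

  x^N+1-length : ∀ N′ → length (x^N+1 N′) P.≡ suc (suc N′)
  x^N+1-length N′ = P.cong suc (P.trans (shift-length N′ (1# ∷ [])) (ℕP.+-comm N′ 1))

  -- 1 + x^N + x^(2N) + … + x^(rN), N = suc N′
  geometric : ℕ → ℕ → List Carrier
  geometric N′ zero = 1# ∷ []
  geometric N′ (suc r) = 1# ∷ shift N′ (geometric N′ r)

  geometric-eval : ∀ N′ r x → eval (geometric N′ (suc r)) x ≈ 1# + x ^ suc N′ * eval (geometric N′ r) x
  geometric-eval N′ r x = +-congˡ (trans (*-congˡ (shift-eval N′ (geometric N′ r) x)) (sym (*-assoc _ _ _)))

  geometric-leading : ∀ N′ r → LeadingNonzero (geometric N′ r)
  geometric-leading N′ zero = 1≉0
  geometric-leading N′ (suc r) with shift N′ (geometric N′ r) | shift-leading N′ (geometric N′ r) (geometric-leading N′ r)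
  ... | [] | ()
  ... | _ ∷ _ | lead = lead

  geometric-length : ∀ N′ r → length (geometric N′ r) P.≡ suc (r ℕ.* suc N′)
  geometric-length N′ zero = P.refl
  geometric-length N′ (suc r) = P.cong suc (P.trans (shift-length N′ (geometric N′ r))
    (P.trans (P.cong (N′ ℕ.+_) (geometric-length N′ r)) (ℕP.+-suc N′ (r ℕ.* suc N′))))

  geometric-sum : ∀ N′ r x → (x ^ suc N′ + 1#) * eval (geometric N′ r) x ≈ x ^ (suc r ℕ.* suc N′) + 1#
  geometric-sum N′ zero x = begin
    (x ^ suc N′ + 1#) * (1# + x * 0#) ≈⟨ *-congˡ (trans (+-congˡ (zeroʳ x)) (+-identityʳ 1#)) ⟩
    (x ^ suc N′ + 1#) * 1#            ≈⟨ *-identityʳ _ ⟩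
    x ^ suc N′ + 1#                   ≈⟨ +-congʳ (^-congʳ x (P.sym (ℕP.+-identityʳ (suc N′)))) ⟩
    x ^ (suc N′ ℕ.+ 0) + 1#           ∎
  geometric-sum N′ (suc r) x = begin
    (y + 1#) * eval (geometric N′ (suc r)) x  ≈⟨ *-congˡ (geometric-eval N′ r x) ⟩
    (y + 1#) * (1# + y * G)                   ≈⟨ solve 2 (λ y G → ((y :+ con 1) :* (con 1 :+ y :* G))
                                                              := (y :+ con 1 :+ y :* ((y :+ con 1) :* G))) refl y G ⟩
    y + 1# + y * ((y + 1#) * G)               ≈⟨ +-congˡ (*-congˡ (geometric-sum N′ r x)) ⟩
    y + 1# + y * (Y + 1#)                     ≈⟨ solve 2 (λ Y y → (y :+ con 1 :+ y :* (Y :+ con 1)) := (y :* Y :+ con 1))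
                                                         refl Y y ⟩
    y * Y + 1#                                ≈⟨ +-congʳ (sym (^-homo-* x (suc N′) (suc r ℕ.* suc N′))) ⟩
    x ^ (suc (suc r) ℕ.* suc N′) + 1#         ∎
    where
    y : Carrier
    y = x ^ suc N′
    Y : Carrier
    Y = x ^ (suc r ℕ.* suc N′)
    G : Carrier
    G = eval (geometric N′ r) x

-- Fermat's little theorem: a^(#𝔽*) = 1 for a ≠ 0.  Multiplying all nonzero elements by a
-- permutes them, so Π x = Π (a x) = a^(#𝔽*) · Π x, and Π x ≠ 0 cancels.
module Fermat {n : ℕ} (F : GF2^ n) where
  open CharTwoField F hiding (zero)
  open Counting F
  open import Data.Fin using (Fin; zero; suc)
  open import Data.Fin.Permutation using (permutation)
  open import Data.List using (length; filter; tabulate)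
  open import Relation.Nullary using (Dec; ¬?)
  open import Algebra.Properties.CommutativeMonoid.Sum *-commutativeMonoid
    using (sum-permute) renaming (sum to ∏)

  ≉0? : ∀ x → Dec (¬ x ≈ 0#)
  ≉0? x = ¬? (x ≟ 0#)

  -- x itself when nonzero, 1 otherwise: the product over all elements then runs over 𝔽*
  unit : Carrier → Carrier
  unit z with z ≟ 0#
  ... | yes _ = 1#
  ... | no _ = z

  unit-≉0 : ∀ z → ¬ unit z ≈ 0#
  unit-≉0 z with z ≟ 0#
  ... | yes _ = 1≉0
  ... | no z≉0 = z≉0

  unit-cong : ∀ {x y} → x ≈ y → unit x ≈ unit y
  unit-cong {x} {y} x≈y with x ≟ 0# | y ≟ 0#
  ... | yes _ | yes _ = refl
  ... | yes x≈0 | no y≉0 = ⊥-elim (y≉0 (trans (sym x≈y) x≈0))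
  ... | no x≉0 | yes y≈0 = ⊥-elim (x≉0 (trans x≈y y≈0))
  ... | no _ | no _ = x≈y

  ∏-cong : ∀ {K} {f g : Fin K → Carrier} → (∀ i → f i ≈ g i) → ∏ f ≈ ∏ g
  ∏-cong {zero} f≈g = refl
  ∏-cong {suc K} f≈g = *-cong (f≈g zero) (∏-cong (λ i → f≈g (suc i)))

  ∏-unit-≉0 : ∀ {K} (e : Fin K → Carrier) → ¬ ∏ (λ i → unit (e i)) ≈ 0#
  ∏-unit-≉0 {zero} e = 1≉0
  ∏-unit-≉0 {suc K} e = *-≉0 (unit-≉0 (e zero)) (∏-unit-≉0 (λ i → e (suc i)))

  module _ (a : Carrier) (a≉0 : ¬ a ≈ 0#) where
    ∏-scale : ∀ {K} (e : Fin K → Carrier) →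
      ∏ (λ i → unit (a * e i)) ≈ a ^ length (filter ≉0? (tabulate e)) * ∏ (λ i → unit (e i))
    ∏-scale {zero} e = sym (*-identityˡ 1#)
    ∏-scale {suc K} e with e zero ≟ 0#
    ... | yes e₀≈0 = begin
      unit (a * e zero) * ∏ (λ i → unit (a * e (suc i)))  ≈⟨ *-cong unit-ae₀ (∏-scale (λ i → e (suc i))) ⟩
      1# * (a ^ L * R)                                    ≈⟨ *-identityˡ _ ⟩
      a ^ L * R                                           ≈⟨ *-congˡ (sym (*-identityˡ R)) ⟩
      a ^ L * (1# * R)                                    ∎
      where
      L : ℕ
      L = length (filter ≉0? (tabulate (λ i → e (suc i))))
      R : Carrier
      R = ∏ (λ i → unit (e (suc i)))
      unit-ae₀ : unit (a * e zero) ≈ 1#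
      unit-ae₀ with (a * e zero) ≟ 0#
      ... | yes _ = refl
      ... | no ae₀≉0 = ⊥-elim (ae₀≉0 (trans (*-congˡ e₀≈0) (zeroʳ a)))
    ... | no e₀≉0 = begin
      unit (a * e zero) * ∏ (λ i → unit (a * e (suc i)))  ≈⟨ *-cong unit-ae₀ (∏-scale (λ i → e (suc i))) ⟩
      (a * e zero) * (a ^ L * R)                          ≈⟨ solve 4 (λ a e A R → ((a :* e) :* (A :* R)) := ((a :* A) :* (e :* R)))
                                                                     refl a (e zero) (a ^ L) R ⟩
      a * a ^ L * (e zero * R)                            ∎
      where
      L : ℕ
      L = length (filter ≉0? (tabulate (λ i → e (suc i))))
      R : Carrier
      R = ∏ (λ i → unit (e (suc i)))
      unit-ae₀ : unit (a * e zero) ≈ a * e zero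
      unit-ae₀ with (a * e zero) ≟ 0#
      ... | yes ae₀≈0 = ⊥-elim (*-≉0 a≉0 e₀≉0 ae₀≈0)
      ... | no _ = refl

    scale : Fin (2 ℕ.^ n) → Fin (2 ℕ.^ n)
    scale i = proj₁ (enum-surj (a * enum i))

    unscale : Fin (2 ℕ.^ n) → Fin (2 ℕ.^ n)
    unscale j = proj₁ (enum-surj (inv a a≉0 * enum j))

    scale-unscale : ∀ j → scale (unscale j) P.≡ j
    scale-unscale j = enum-inj _ j (begin
      enum (scale (unscale j))         ≈⟨ proj₂ (enum-surj _) ⟩
      a * enum (unscale j)             ≈⟨ *-congˡ (proj₂ (enum-surj _)) ⟩
      a * (inv a a≉0 * enum j)         ≈⟨ sym (*-assoc _ _ _) ⟩
      a * inv a a≉0 * enum j           ≈⟨ *-congʳ (*-inv a a≉0) ⟩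
      1# * enum j                      ≈⟨ *-identityˡ _ ⟩
      enum j                           ∎)

    unscale-scale : ∀ i → unscale (scale i) P.≡ i
    unscale-scale i = enum-inj _ i (begin
      enum (unscale (scale i))         ≈⟨ proj₂ (enum-surj _) ⟩
      inv a a≉0 * enum (scale i)       ≈⟨ *-congˡ (proj₂ (enum-surj _)) ⟩
      inv a a≉0 * (a * enum i)         ≈⟨ sym (*-assoc _ _ _) ⟩
      inv a a≉0 * a * enum i           ≈⟨ *-congʳ (trans (*-comm _ _) (*-inv a a≉0)) ⟩
      1# * enum i                      ≈⟨ *-identityˡ _ ⟩
      enum i                           ∎)

    fermat : a ^ count (λ x → ¬ x ≈ 0#) ≉0? ≈ 1#
    fermat = cancelʳ (∏-unit-≉0 enum) (begin
      a ^ count _ ≉0? * R                   ≈⟨ *-congʳ (^-congʳ a (count≡ ≉0?)) ⟩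
      a ^ length (filter ≉0? elements) * R  ≈⟨ sym (∏-scale enum) ⟩
      ∏ (λ i → unit (a * enum i))           ≈⟨ sym (∏-cong (λ i → unit-cong (proj₂ (enum-surj (a * enum i))))) ⟩
      ∏ (λ i → unit (enum (scale i)))       ≈⟨ sym (sum-permute (λ i → unit (enum i))
                                                     (permutation scale unscale scale-unscale unscale-scale)) ⟩
      R                                     ≈⟨ sym (*-identityˡ R) ⟩
      1# * R                                ∎)
      where
      R : Carrier
      R = ∏ (λ i → unit (enum i))

-- There are at most N
-- (roots of 1 + x^N); writing 2^n − 1 = (r+1)·N, the nonzero non-roots are roots of
-- 1 + x^N + … + x^(rN) by Fermat, so there are at most r·N of them, leaving at least N roots.
module RootsOfUnity {n : ℕ} (F : GF2^ n) where
  open CharTwoField F hiding (zero)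
  open Counting F
  open Polynomials F
  open Fermat F using (≉0?; fermat)
  open import Data.Nat.Divisibility using (_∣_; divides)
  open import Data.List using (List; []; _∷_; length)
  open import Data.List.Properties using (length-tabulate; filter-all)
  import Data.List.Relation.Unary.All as All
  import Data.List.Relation.Unary.AllPairs as AllPairs
  open import Data.Unit using (⊤; tt)
  open import Relation.Nullary using (Dec; ¬?)

  -- exactly one element equals c (the polynomial c + x has one root)
  count-≈ : ∀ c → count (_≈ c) (_≟ c) P.≡ 1
  count-≈ c = ℕP.≤-antisym at-most-one at-least-one
    where
    eval-c+x : ∀ x → eval (c ∷ 1# ∷ []) x ≈ c + x
    eval-c+x x = +-congˡ (trans (*-congˡ (trans (+-congˡ (zeroʳ x)) (+-identityʳ 1#))) (*-identityʳ x))
    at-most-one : count (_≈ c) (_≟ c) ℕ.≤ 1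
    at-most-one = count-upper (_≟ c) 1 λ xs xs-unique all-≈c →
      ℕP.≤-pred (root-bound (c ∷ 1# ∷ []) 1≉0 xs xs-unique
        (All.map (λ {x} x≈c → trans (eval-c+x x) (≈⇒sum≈0 (sym x≈c))) all-≈c))
    at-least-one : 1 ℕ.≤ count (_≈ c) (_≟ c)
    at-least-one = count-lower (_≟ c) (λ x≈y x≈c → trans (sym x≈y) x≈c)
                     (c ∷ []) (All.[] AllPairs.∷ AllPairs.[]) (refl All.∷ All.[])

  count-≉0 : count (λ x → ¬ x ≈ 0#) ≉0? P.≡ 2 ℕ.^ n ℕ.∸ 1
  count-≉0 = P.cong (ℕ._∸ 1) (P.trans (P.cong (ℕ._+ count _ ≉0?) (P.sym (count-≈ 0#)))
    (P.trans (P.sym (count-⊎ any? (_≟ 0#) ≉0? zero-or-not (λ _ _ → tt) (λ _ _ → tt) (λ _ x≈0 x≉0 → x≉0 x≈0)))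
             count-all))
    where
    any? : ∀ (x : Carrier) → Dec ⊤
    any? _ = yes tt
    zero-or-not : ∀ x → ⊤ → x ≈ 0# ⊎ ¬ x ≈ 0#
    zero-or-not x _ with x ≟ 0#
    ... | yes x≈0 = inj₁ x≈0
    ... | no x≉0 = inj₂ x≉0
    count-all : count (λ _ → ⊤) any? P.≡ 2 ℕ.^ n
    count-all = P.trans (count≡ any?)
      (P.trans (P.cong length (filter-all any? (All.universal (λ _ → tt) elements))) (length-tabulate enum))

  root? : ∀ N x → Dec (x ^ N ≈ 1#)
  root? N x = (x ^ N) ≟ 1#

  non-root? : ∀ N x → Dec (¬ x ≈ 0# × ¬ x ^ N ≈ 1#)
  non-root? N x = ≉0? x ×-dec ¬? (root? N x)

  -- at most N roots of x^N = 1: they are roots of 1 + x^N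
  roots-at-most : ∀ N′ → count (λ x → x ^ suc N′ ≈ 1#) (root? (suc N′)) ℕ.≤ suc N′
  roots-at-most N′ = count-upper (root? (suc N′)) (suc N′) λ xs xs-unique all-roots →
    ℕP.≤-pred (P.subst (length xs ℕ.<_) (x^N+1-length N′)
      (root-bound (x^N+1 N′) (x^N+1-leading N′) xs xs-unique
        (All.map (λ {x} x^N≈1 → trans (x^N+1-eval N′ x) (trans (+-congˡ x^N≈1) char2)) all-roots)))

  -- if #𝔽* = (r+1)N, at most r·N nonzero elements are not N-th roots of unity:
  -- (x^N + 1)(1 + x^N + … + x^(rN)) = x^(#𝔽*) + 1 = 0 forces the second factor to vanish
  non-roots-at-most : ∀ N′ r → 2 ℕ.^ n ℕ.∸ 1 P.≡ suc r ℕ.* suc N′ →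
    count (λ x → ¬ x ≈ 0# × ¬ x ^ suc N′ ≈ 1#) (non-root? (suc N′)) ℕ.≤ r ℕ.* suc N′
  non-roots-at-most N′ r #𝔽*≡ = count-upper (non-root? (suc N′)) (r ℕ.* suc N′) λ xs xs-unique all-non-roots →
    ℕP.≤-pred (P.subst (length xs ℕ.<_) (geometric-length N′ r)
      (root-bound (geometric N′ r) (geometric-leading N′ r) xs xs-unique (All.map (λ {x} → root-of-geometric x) all-non-roots)))
    where
    root-of-geometric : ∀ x → ¬ x ≈ 0# × ¬ x ^ suc N′ ≈ 1# → eval (geometric N′ r) x ≈ 0#
    root-of-geometric x (x≉0 , x^N≉1) with zero-product product≈0
      where
      x^#𝔽*≈1 : x ^ (suc r ℕ.* suc N′) ≈ 1#
      x^#𝔽*≈1 = trans (^-congʳ x (P.sym (P.trans count-≉0 #𝔽*≡))) (fermat x x≉0)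
      product≈0 : (x ^ suc N′ + 1#) * eval (geometric N′ r) x ≈ 0#
      product≈0 = trans (geometric-sum N′ r x) (trans (+-congʳ x^#𝔽*≈1) char2)
    ... | inj₁ x^N+1≈0 = ⊥-elim (x^N≉1 (sum≈0⇒≈ x^N+1≈0))
    ... | inj₂ geometric≈0 = geometric≈0

  #𝔽*≢0 : 1 ℕ.≤ n → ¬ 2 ℕ.^ n ℕ.∸ 1 P.≡ 0
  #𝔽*≢0 1≤n #𝔽*≡0 = ℕP.<-irrefl (P.sym #𝔽*≡0) (ℕP.m<n⇒0<n∸m 1<2^n)
    where
    1<2^n : 1 ℕ.< 2 ℕ.^ n
    1<2^n = ℕP.<-≤-trans (ℕ.s≤s (ℕ.s≤s ℕ.z≤n))
              (P.subst (ℕ._≤ 2 ℕ.^ n) (ℕP.^-identityʳ 2) (ℕP.^-monoʳ-≤ 2 1≤n))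

  count-roots : ∀ N → 1 ℕ.≤ n → N ∣ 2 ℕ.^ n ℕ.∸ 1 → count (λ x → x ^ N ≈ 1#) (root? N) P.≡ N
  count-roots zero 1≤n (divides c #𝔽*≡) = ⊥-elim (#𝔽*≢0 1≤n (P.trans #𝔽*≡ (ℕP.*-zeroʳ c)))
  count-roots (suc N′) 1≤n (divides zero #𝔽*≡) = ⊥-elim (#𝔽*≢0 1≤n #𝔽*≡)
  count-roots (suc N′) _ (divides (suc r) #𝔽*≡) = ℕP.≤-antisym (roots-at-most N′) at-least-N
    where
    N : ℕ
    N = suc N′
    Root : Carrier → Set
    Root x = x ^ N ≈ 1#
    NonzeroRoot? : ∀ x → Dec (¬ x ≈ 0# × Root x)
    NonzeroRoot? x = ≉0? x ×-dec root? N x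
    roots-nonzero : count _ NonzeroRoot? P.≡ count Root (root? N)
    roots-nonzero = count-≐ NonzeroRoot? (root? N) proj₂
      (λ x^N≈1 → (λ x≈0 → 1≉0 (trans (sym x^N≈1) (trans (^-congˡ N x≈0) (0^suc N′)))) , x^N≈1)
    nonzero-split : count _ ≉0? P.≡ count _ NonzeroRoot? ℕ.+ count _ (non-root? N)
    nonzero-split = count-⊎ ≉0? NonzeroRoot? (non-root? N) root-or-not (λ _ → proj₁) (λ _ → proj₁)
                      (λ _ root non-root → proj₂ non-root (proj₂ root))
      where
      root-or-not : ∀ x → ¬ x ≈ 0# → (¬ x ≈ 0# × Root x) ⊎ (¬ x ≈ 0# × ¬ Root x)
      root-or-not x x≉0 with root? N x
      ... | yes root = inj₁ (x≉0 , root)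
      ... | no non-root = inj₂ (x≉0 , non-root)
    at-least-N : N ℕ.≤ count Root (root? N)
    at-least-N = ℕP.+-cancelʳ-≤ (r ℕ.* N) N _ (ℕP.≤-trans (ℕP.≤-reflexive N+rN≡)
      (ℕP.≤-trans (ℕP.+-monoʳ-≤ (count _ NonzeroRoot?) (non-roots-at-most N′ r #𝔽*≡))
                  (ℕP.≤-reflexive (P.cong (ℕ._+ r ℕ.* N) roots-nonzero))))
      where
      N+rN≡ : N ℕ.+ r ℕ.* N P.≡ count _ NonzeroRoot? ℕ.+ count _ (non-root? N)
      N+rN≡ = P.trans (P.sym (P.trans count-≉0 #𝔽*≡)) nonzero-split

-- The map φ(g) = g^(q−1) is a bijection from 𝒯₁ onto
-- the (q+1)-th roots of unity other than 1, with inverse y ↦ 1/(y + 1).  A condition on g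
-- corresponding under φ to y^E = 1 then carves out the gcd(E, q+1)-th roots of unity.
module UnitCircle (m : ℕ) (1≤m : 1 ℕ.≤ m) (F : GF2^ (2 ℕ.* m)) where
  open CharTwoField F hiding (zero)
  open Counting F
  open RootsOfUnity F using (count-≈; root?; count-roots)
  open TraceOne F m using (q; 𝒯₁; conjugate)
  open import Data.Nat.Divisibility using (_∣_; divides; ∣-trans; ∣-refl)
  open import Data.Nat.GCD using (gcd[m,n]∣m; gcd[m,n]∣n)
  open import Relation.Nullary using (Dec; ¬?)
  open PowersOfTwo using (gcd-closed; 2^+1-∣-mersenne)

  q-1+1 : q ℕ.∸ 1 ℕ.+ 1 P.≡ q
  q-1+1 = ℕP.m∸n+n≡m (ℕP.m^n>0 2 m)

  𝒯₁-resp : ∀ {x y} → x ≈ y → 𝒯₁ x → 𝒯₁ y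
  𝒯₁-resp x≈y x∈𝒯₁ = trans (sym (+-cong x≈y (^-congˡ q x≈y))) x∈𝒯₁

  In𝒫 : Carrier → Set
  In𝒫 y = ∃ λ X → ¬ (X ≈ 0#) × X ^ (q ℕ.∸ 1) ≈ y

  module Forward {g : Carrier} (g∈𝒯₁ : 𝒯₁ g) where
    g≉0 : ¬ g ≈ 0#
    g≉0 g≈0 = 1≉0 (begin
      1#                     ≈⟨ sym g∈𝒯₁ ⟩
      g + g ^ q              ≈⟨ +-cong g≈0 (^-congˡ q g≈0) ⟩
      0# + 0# ^ q            ≈⟨ +-identityˡ _ ⟩
      0# ^ q                 ≡⟨ P.cong (0# ^_) (P.trans (P.sym q-1+1) (ℕP.+-comm (q ℕ.∸ 1) 1)) ⟩
      0# ^ suc (q ℕ.∸ 1)     ≈⟨ 0^suc (q ℕ.∸ 1) ⟩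
      0#                     ∎)

    φ : Carrier
    φ = g ^ (q ℕ.∸ 1)

    -- φ(g)·g = g^q = g + 1
    φg≈g+1 : φ * g ≈ g + 1#
    φg≈g+1 = trans (sym (^-+1 g (q ℕ.∸ 1))) (trans (^-congʳ g q-1+1) (conjugate g∈𝒯₁))

    φ≉0 : ¬ φ ≈ 0#
    φ≉0 φ≈0 = ^-≉0 q g≉0 (trans (conjugate g∈𝒯₁) (trans (sym φg≈g+1) (trans (*-congʳ φ≈0) (zeroˡ g))))

    φ≉1 : ¬ φ ≈ 1#
    φ≉1 φ≈1 = 1≉0 (begin
      1#              ≈⟨ sym (x+[x+1] g) ⟩
      g + (g + 1#)    ≈⟨ +-congˡ (sym φg≈g+1) ⟩
      g + φ * g       ≈⟨ +-congˡ (trans (*-congʳ φ≈1) (*-identityˡ g)) ⟩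
      g + g           ≈⟨ x+x≈0 g ⟩
      0#              ∎)

    -- (φ(g)·g)^(q+1) = (g + 1)^q·(g + 1) = g·g^q = g^(q+1), so φ(g)^(q+1) = 1
    φ^[q+1]≈1 : φ ^ (q ℕ.+ 1) ≈ 1#
    φ^[q+1]≈1 = cancelʳ (^-≉0 (q ℕ.+ 1) g≉0) (begin
      φ ^ (q ℕ.+ 1) * g ^ (q ℕ.+ 1)  ≈⟨ sym (^-distrib-* φ g (q ℕ.+ 1)) ⟩
      (φ * g) ^ (q ℕ.+ 1)            ≈⟨ ^-congˡ (q ℕ.+ 1) φg≈g+1 ⟩
      (g + 1#) ^ (q ℕ.+ 1)           ≈⟨ ^-+1 (g + 1#) q ⟩
      (g + 1#) ^ q * (g + 1#)        ≈⟨ *-congʳ (trans (frobenius-+1 m g) (+-congʳ (conjugate g∈𝒯₁))) ⟩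
      (g + 1# + 1#) * (g + 1#)       ≈⟨ *-cong (+1+1 g) (sym (conjugate g∈𝒯₁)) ⟩
      g * g ^ q                      ≈⟨ *-comm g (g ^ q) ⟩
      g ^ q * g                      ≈⟨ sym (^-+1 g q) ⟩
      g ^ (q ℕ.+ 1)                  ≈⟨ sym (*-identityˡ _) ⟩
      1# * g ^ (q ℕ.+ 1)             ∎)

  module Backward {y : Carrier} (y^[q+1]≈1 : y ^ (q ℕ.+ 1) ≈ 1#) (y≉1 : ¬ y ≈ 1#) where
    y+1≉0 : ¬ y + 1# ≈ 0#
    y+1≉0 y+1≈0 = y≉1 (sum≈0⇒≈ y+1≈0)

    ψ : Carrier
    ψ = inv (y + 1#) y+1≉0

    [y+1]ψ≈1 : (y + 1#) * ψ ≈ 1#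
    [y+1]ψ≈1 = *-inv (y + 1#) y+1≉0

    ψ≉0 : ¬ ψ ≈ 0#
    ψ≉0 ψ≈0 = 1≉0 (trans (sym [y+1]ψ≈1) (trans (*-congˡ ψ≈0) (zeroʳ _)))

    ψ-frobenius : ∀ j → ψ ^ (2 ℕ.^ j) * (y ^ (2 ℕ.^ j) + 1#) ≈ 1#
    ψ-frobenius j = begin
      ψ ^ e * (y ^ e + 1#)    ≈⟨ *-congˡ (sym (frobenius-+1 j y)) ⟩
      ψ ^ e * (y + 1#) ^ e    ≈⟨ sym (^-distrib-* ψ (y + 1#) e) ⟩
      (ψ * (y + 1#)) ^ e      ≈⟨ ^-congˡ e (trans (*-comm ψ _) [y+1]ψ≈1) ⟩
      1# ^ e                  ≈⟨ 1^ e ⟩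
      1#                      ∎
      where
      e : ℕ
      e = 2 ℕ.^ j

    -- if y^(2^j+1) = 1 then ψ^(2^j) = y·ψ: both are inverses of y^(2^j) + 1
    ψ-twist : ∀ j → y ^ (2 ℕ.^ j ℕ.+ 1) ≈ 1# → ψ ^ (2 ℕ.^ j) ≈ y * ψ
    ψ-twist j y^[e+1]≈1 = cancelʳ y^e+1≉0 (trans (ψ-frobenius j) (sym yψ-inverse))
      where
      e : ℕ
      e = 2 ℕ.^ j
      y^e+1≉0 : ¬ (y ^ e + 1#) ≈ 0#
      y^e+1≉0 ≈0 = 1≉0 (trans (sym (ψ-frobenius j)) (trans (*-congˡ ≈0) (zeroʳ _)))
      yψ-inverse : y * ψ * (y ^ e + 1#) ≈ 1#
      yψ-inverse = begin
        y * ψ * (y ^ e + 1#)    ≈⟨ solve 3 (λ y ψ Y → (y :* ψ :* (Y :+ con 1)) := (ψ :* (Y :* y :+ y))) refl y ψ (y ^ e) ⟩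
        ψ * (y ^ e * y + y)     ≈⟨ *-congˡ (+-congʳ (trans (sym (^-+1 y e)) y^[e+1]≈1)) ⟩
        ψ * (1# + y)            ≈⟨ trans (*-comm ψ _) (trans (*-congʳ (+-comm 1# y)) [y+1]ψ≈1) ⟩
        1#                      ∎

    ψ^q≈yψ : ψ ^ q ≈ y * ψ
    ψ^q≈yψ = ψ-twist m y^[q+1]≈1

    ψ∈𝒯₁ : 𝒯₁ ψ
    ψ∈𝒯₁ = begin
      ψ + ψ ^ q        ≈⟨ +-congˡ ψ^q≈yψ ⟩
      ψ + y * ψ        ≈⟨ solve 2 (λ ψ y → (ψ :+ y :* ψ) := ((y :+ con 1) :* ψ)) refl ψ y ⟩
      (y + 1#) * ψ     ≈⟨ [y+1]ψ≈1 ⟩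
      1#               ∎

    φψ≈y : ψ ^ (q ℕ.∸ 1) ≈ y
    φψ≈y = cancelʳ ψ≉0 (trans (sym (^-+1 ψ (q ℕ.∸ 1))) (trans (^-congʳ ψ q-1+1) ψ^q≈yψ))

  Root : Carrier → ℕ → Set
  Root y j = y ^ j ≈ 1#

  root-gcd : ∀ y a b → Root y a → Root y b → Root y (gcd a b)
  root-gcd y = gcd-closed (Root y) refl
    (λ a b y^a≈1 y^b≈1 → trans (^-homo-* y a b) (trans (*-cong y^a≈1 y^b≈1) (*-identityˡ 1#)))
    (λ a b y^[a+b]≈1 y^b≈1 → trans (sym (*-identityʳ _))
                               (trans (*-congˡ (sym y^b≈1)) (trans (sym (^-homo-* y a b)) y^[a+b]≈1)))

  root-multiple : ∀ y {N X} → N ∣ X → Root y N → Root y X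
  root-multiple y {N} (divides c P.refl) y^N≈1 =
    trans (^-congʳ y (ℕP.*-comm c N)) (trans (^-* y N c) (trans (^-congˡ c y^N≈1) (1^ c)))

  -- φ is injective on 𝒯₁: φ(g) = φ(g′) = y gives y·(g + g′) = g + g′ with y ≠ 1
  φ-injective : ∀ {g g′} (g∈𝒯₁ : 𝒯₁ g) (g′∈𝒯₁ : 𝒯₁ g′) →
                g ^ (q ℕ.∸ 1) ≈ g′ ^ (q ℕ.∸ 1) → g ≈ g′
  φ-injective {g} {g′} g∈𝒯₁ g′∈𝒯₁ φg≈φg′ with zero-product [y+1][g+g′]≈0
    where
    open Forward g∈𝒯₁ using (φ; φg≈g+1)
    y[g+g′]≈g+g′ : φ * (g + g′) ≈ g + g′
    y[g+g′]≈g+g′ = begin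
      φ * (g + g′)              ≈⟨ distribˡ φ g g′ ⟩
      φ * g + φ * g′            ≈⟨ +-cong φg≈g+1 (trans (*-congʳ φg≈φg′) (Forward.φg≈g+1 g′∈𝒯₁)) ⟩
      g + 1# + (g′ + 1#)        ≈⟨ +1-cancel g g′ ⟩
      g + g′                    ∎
    [y+1][g+g′]≈0 : (φ + 1#) * (g + g′) ≈ 0#
    [y+1][g+g′]≈0 = trans (distribʳ (g + g′) φ 1#) (trans (+-congˡ (*-identityˡ _)) (≈⇒sum≈0 y[g+g′]≈g+g′))
  ... | inj₁ φ+1≈0 = ⊥-elim (Forward.φ≉1 g∈𝒯₁ (sum≈0⇒≈ φ+1≈0))
  ... | inj₂ g+g′≈0 = sum≈0⇒≈ g+g′≈0

  -- ψ is injective: y + 1 and y′ + 1 are both the inverse of ψ(y) = ψ(y′)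
  ψ-injective : ∀ {y y′} (y^[q+1]≈1 : y ^ (q ℕ.+ 1) ≈ 1#) (y≉1 : ¬ y ≈ 1#)
                (y′^[q+1]≈1 : y′ ^ (q ℕ.+ 1) ≈ 1#) (y′≉1 : ¬ y′ ≈ 1#) →
    Backward.ψ y^[q+1]≈1 y≉1 ≈ Backward.ψ y′^[q+1]≈1 y′≉1 → y ≈ y′
  ψ-injective {y} {y′} y^[q+1]≈1 y≉1 y′^[q+1]≈1 y′≉1 ψ≈ψ′ = begin
    y                ≈⟨ sym (+1+1 y) ⟩
    y + 1# + 1#      ≈⟨ +-congʳ y+1≈y′+1 ⟩
    y′ + 1# + 1#     ≈⟨ +1+1 y′ ⟩
    y′               ∎
    where
    y+1≈y′+1 : y + 1# ≈ y′ + 1#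
    y+1≈y′+1 = cancelʳ (Backward.ψ≉0 y^[q+1]≈1 y≉1)
      (trans (Backward.[y+1]ψ≈1 y^[q+1]≈1 y≉1) (sym (trans (*-congˡ ψ≈ψ′) (Backward.[y+1]ψ≈1 y′^[q+1]≈1 y′≉1))))

  -- A condition C on 𝒯₁ which φ turns into y^E = 1 (and ψ turns back).  The set
  -- Z = {g ∈ 𝒯₁ : C g} then corresponds to the gcd(E, q+1)-th roots of unity other than 1.
  module Correspondence (E : ℕ) (C : Carrier → Set) (C? : ∀ g → Dec (C g))
                        (C-resp : ∀ {x y} → x ≈ y → C x → C y)
                        (φ-root : ∀ {g} (g∈𝒯₁ : 𝒯₁ g) → C g → Forward.φ g∈𝒯₁ ^ E ≈ 1#)
                        (ψ-condition : ∀ {y} (y^[q+1]≈1 : y ^ (q ℕ.+ 1) ≈ 1#) (y≉1 : ¬ y ≈ 1#) →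
                                       y ^ E ≈ 1# → C (Backward.ψ y^[q+1]≈1 y≉1)) where
    N : ℕ
    N = gcd E (q ℕ.+ 1)

    Z : Carrier → Set
    Z g = 𝒯₁ g × C g

    Z? : ∀ g → Dec (Z g)
    Z? g = ((g + g ^ q) ≟ 1#) ×-dec C? g

    Root′ : Carrier → Set
    Root′ y = y ^ N ≈ 1# × ¬ y ≈ 1#

    Root′? : ∀ y → Dec (Root′ y)
    Root′? y = root? N y ×-dec ¬? (y ≟ 1#)

    φ-Root′ : ∀ g → Z g → Root′ (g ^ (q ℕ.∸ 1))
    φ-Root′ g (g∈𝒯₁ , Cg) =
        root-gcd (Forward.φ g∈𝒯₁) E (q ℕ.+ 1) (φ-root g∈𝒯₁ Cg) (Forward.φ^[q+1]≈1 g∈𝒯₁)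
      , Forward.φ≉1 g∈𝒯₁

    Root′⇒q+1 : ∀ {y} → y ^ N ≈ 1# → y ^ (q ℕ.+ 1) ≈ 1#
    Root′⇒q+1 {y} = root-multiple y (gcd[m,n]∣n E (q ℕ.+ 1))

    Root′⇒E : ∀ {y} → y ^ N ≈ 1# → y ^ E ≈ 1#
    Root′⇒E {y} = root-multiple y (gcd[m,n]∣m E (q ℕ.+ 1))

    ψ′ : ∀ y → Root′ y → Carrier
    ψ′ y (y^N≈1 , y≉1) = Backward.ψ (Root′⇒q+1 y^N≈1) y≉1

    ψ-Z : ∀ y (r : Root′ y) → Z (ψ′ y r)
    ψ-Z y (y^N≈1 , y≉1) =
      Backward.ψ∈𝒯₁ (Root′⇒q+1 y^N≈1) y≉1 , ψ-condition (Root′⇒q+1 y^N≈1) y≉1 (Root′⇒E y^N≈1)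

    image : ∀ y → (((∃ λ g → Z g × g ^ (q ℕ.∸ 1) ≈ y) ⊎ y ≈ 1#) → In𝒫 y × y ^ N ≈ 1#)
                × ((In𝒫 y × y ^ N ≈ 1#) → ((∃ λ g → Z g × g ^ (q ℕ.∸ 1) ≈ y) ⊎ y ≈ 1#))
    image y = image⊆ , ⊆image
      where
      image⊆ : ((∃ λ g → Z g × g ^ (q ℕ.∸ 1) ≈ y) ⊎ y ≈ 1#) → In𝒫 y × y ^ N ≈ 1#
      image⊆ (inj₁ (g , Zg@(g∈𝒯₁ , _) , φg≈y)) =
        (g , Forward.g≉0 g∈𝒯₁ , φg≈y) , trans (^-congˡ N (sym φg≈y)) (proj₁ (φ-Root′ g Zg))
      image⊆ (inj₂ y≈1) = (1# , 1≉0 , trans (1^ (q ℕ.∸ 1)) (sym y≈1)) , trans (^-congˡ N y≈1) (1^ N)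
      ⊆image : (In𝒫 y × y ^ N ≈ 1#) → ((∃ λ g → Z g × g ^ (q ℕ.∸ 1) ≈ y) ⊎ y ≈ 1#)
      ⊆image (_ , y^N≈1) with y ≟ 1#
      ... | yes y≈1 = inj₂ y≈1
      ... | no y≉1 = inj₁ (ψ′ y (y^N≈1 , y≉1) , ψ-Z y (y^N≈1 , y≉1) , Backward.φψ≈y (Root′⇒q+1 y^N≈1) y≉1)

    -- #Z = N − 1, since φ and ψ are mutually inverse injections and there are N N-th roots of unity
    count-Z : count Z Z? P.≡ N ℕ.∸ 1
    count-Z = P.trans #Z≡#Root′ (P.cong (ℕ._∸ 1) (P.sym N≡1+#Root′))
      where
      #Z≡#Root′ : count Z Z? P.≡ count Root′ Root′?
      #Z≡#Root′ = ℕP.≤-antisym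
        (count-injection Z? Root′? (λ g _ → g ^ (q ℕ.∸ 1)) φ-Root′
          (λ g g′ (g∈𝒯₁ , _) (g′∈𝒯₁ , _) → φ-injective g∈𝒯₁ g′∈𝒯₁)
          (λ x≈y (x^N≈1 , x≉1) → trans (sym (^-congˡ N x≈y)) x^N≈1 , λ y≈1 → x≉1 (trans x≈y y≈1)))
        (count-injection Root′? Z? ψ′ ψ-Z
          (λ y y′ (y^N≈1 , y≉1) (y′^N≈1 , y′≉1) →
             ψ-injective (Root′⇒q+1 y^N≈1) y≉1 (Root′⇒q+1 y′^N≈1) y′≉1)
          (λ x≈y (x∈𝒯₁ , Cx) → 𝒯₁-resp x≈y x∈𝒯₁ , C-resp x≈y Cx))
      N∣#𝔽* : N ∣ 2 ℕ.^ (2 ℕ.* m) ℕ.∸ 1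
      N∣#𝔽* = ∣-trans (gcd[m,n]∣n E (q ℕ.+ 1)) (2^+1-∣-mersenne {m} ∣-refl)
      N≡1+#Root′ : N P.≡ 1 ℕ.+ count Root′ Root′?
      N≡1+#Root′ = P.trans (P.sym (count-roots N (ℕP.*-mono-≤ {1} {2} (ℕ.s≤s ℕ.z≤n) 1≤m) N∣#𝔽*))
        (P.trans (count-⊎ (root? N) One? Root′? one-or-other (λ _ → proj₁) (λ _ → proj₁)
                           (λ _ one other → proj₂ other (proj₂ one)))
                 (P.cong (ℕ._+ count Root′ Root′?) #One≡1))
        where
        One? : ∀ y → Dec (y ^ N ≈ 1# × y ≈ 1#)
        One? y = root? N y ×-dec (y ≟ 1#)
        one-or-other : ∀ y → y ^ N ≈ 1# → (y ^ N ≈ 1# × y ≈ 1#) ⊎ Root′ y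
        one-or-other y y^N≈1 with y ≟ 1#
        ... | yes y≈1 = inj₁ (y^N≈1 , y≈1)
        ... | no y≉1 = inj₂ (y^N≈1 , y≉1)
        #One≡1 : count _ One? P.≡ 1
        #One≡1 = P.trans (count-≐ One? (_≟ 1#) proj₂ (λ y≈1 → trans (^-congˡ N y≈1) (1^ N) , y≈1)) (count-≈ 1#)

  -- The two conditions of (v), g^(2^k) + g = ε for ε ∈ {0, 1}, correspond under φ to
  -- y^(2^k − 1) = 1 and y^(2^k + 1) = 1 respectively.
  module Conditions (k : ℕ) where
    K : ℕ
    K = 2 ℕ.^ k

    K-1+1 : K ℕ.∸ 1 ℕ.+ 1 P.≡ K
    K-1+1 = ℕP.m∸n+n≡m (ℕP.m^n>0 2 k)

    C₀ : Carrier → Set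
    C₀ g = g ^ K + g ≈ 0#

    C₁ : Carrier → Set
    C₁ g = g ^ K + g ≈ 1#

    C-resp : ∀ {ε x y} → x ≈ y → x ^ K + x ≈ ε → y ^ K + y ≈ ε
    C-resp x≈y Cx = trans (sym (+-cong (^-congˡ K x≈y) x≈y)) Cx

    -- conjugating φ(g)·g = g + 1 by x ↦ x^K
    φ^K-g^K : ∀ {g} (g∈𝒯₁ : 𝒯₁ g) → Forward.φ g∈𝒯₁ ^ K * g ^ K ≈ g ^ K + 1#
    φ^K-g^K {g} g∈𝒯₁ =
      trans (sym (^-distrib-* (Forward.φ g∈𝒯₁) g K)) (trans (^-congˡ K (Forward.φg≈g+1 g∈𝒯₁)) (frobenius-+1 k g))

    -- g^K = g gives φ(g)^K = φ(g), i.e. φ(g)^(K−1) = 1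
    φ-root₀ : ∀ {g} (g∈𝒯₁ : 𝒯₁ g) → C₀ g → Forward.φ g∈𝒯₁ ^ (K ℕ.∸ 1) ≈ 1#
    φ-root₀ {g} g∈𝒯₁ C₀g = cancelʳ (Forward.φ≉0 g∈𝒯₁) (begin
      y ^ (K ℕ.∸ 1) * y    ≈⟨ sym (^-+1 y (K ℕ.∸ 1)) ⟩
      y ^ (K ℕ.∸ 1 ℕ.+ 1)  ≡⟨ P.cong (y ^_) K-1+1 ⟩
      y ^ K                ≈⟨ y^K≈y ⟩
      y                    ≈⟨ sym (*-identityˡ y) ⟩
      1# * y               ∎)
      where
      y : Carrier
      y = Forward.φ g∈𝒯₁
      g^K≈g : g ^ K ≈ g
      g^K≈g = sum≈0⇒≈ C₀g
      y^K≈y : y ^ K ≈ y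
      y^K≈y = cancelʳ (Forward.g≉0 g∈𝒯₁) (begin
        y ^ K * g      ≈⟨ *-congˡ (sym g^K≈g) ⟩
        y ^ K * g ^ K  ≈⟨ φ^K-g^K g∈𝒯₁ ⟩
        g ^ K + 1#     ≈⟨ +-congʳ g^K≈g ⟩
        g + 1#         ≈⟨ sym (Forward.φg≈g+1 g∈𝒯₁) ⟩
        y * g          ∎)

    -- g^K = g + 1 gives φ(g)^K·φ(g)·g = g, i.e. φ(g)^(K+1) = 1
    φ-root₁ : ∀ {g} (g∈𝒯₁ : 𝒯₁ g) → C₁ g → Forward.φ g∈𝒯₁ ^ (K ℕ.+ 1) ≈ 1#
    φ-root₁ {g} g∈𝒯₁ C₁g = trans (^-+1 y K) (cancelʳ (Forward.g≉0 g∈𝒯₁) (begin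
      y ^ K * y * g     ≈⟨ *-assoc _ _ _ ⟩
      y ^ K * (y * g)   ≈⟨ *-congˡ (trans (Forward.φg≈g+1 g∈𝒯₁) (sym g^K≈g+1)) ⟩
      y ^ K * g ^ K     ≈⟨ φ^K-g^K g∈𝒯₁ ⟩
      g ^ K + 1#        ≈⟨ +-congʳ g^K≈g+1 ⟩
      g + 1# + 1#       ≈⟨ +1+1 g ⟩
      g                 ≈⟨ sym (*-identityˡ g) ⟩
      1# * g            ∎))
      where
      y : Carrier
      y = Forward.φ g∈𝒯₁
      g^K≈g+1 : g ^ K ≈ g + 1#
      g^K≈g+1 = move C₁g

    -- y^(K−1) = 1 gives y^K = y, so ψ(y)^K and ψ(y) both invert y + 1
    ψ-condition₀ : ∀ {y} (y^[q+1]≈1 : y ^ (q ℕ.+ 1) ≈ 1#) (y≉1 : ¬ y ≈ 1#) →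
                   y ^ (K ℕ.∸ 1) ≈ 1# → C₀ (Backward.ψ y^[q+1]≈1 y≉1)
    ψ-condition₀ {y} y^[q+1]≈1 y≉1 y^[K-1]≈1 = ≈⇒sum≈0 ψ^K≈ψ
      where
      open Backward y^[q+1]≈1 y≉1
      y^K≈y : y ^ K ≈ y
      y^K≈y = trans (^-congʳ y (P.sym K-1+1)) (trans (^-+1 y (K ℕ.∸ 1)) (trans (*-congʳ y^[K-1]≈1) (*-identityˡ y)))
      ψ^K≈ψ : ψ ^ K ≈ ψ
      ψ^K≈ψ = cancelʳ y+1≉0 (begin
        ψ ^ K * (y + 1#)       ≈⟨ *-congˡ (+-congʳ (sym y^K≈y)) ⟩
        ψ ^ K * (y ^ K + 1#)   ≈⟨ ψ-frobenius k ⟩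
        1#                     ≈⟨ sym [y+1]ψ≈1 ⟩
        (y + 1#) * ψ           ≈⟨ *-comm _ ψ ⟩
        ψ * (y + 1#)           ∎)

    -- y^(K+1) = 1 gives ψ(y)^K = y·ψ(y) = ψ(y)^q = ψ(y) + 1
    ψ-condition₁ : ∀ {y} (y^[q+1]≈1 : y ^ (q ℕ.+ 1) ≈ 1#) (y≉1 : ¬ y ≈ 1#) →
                   y ^ (K ℕ.+ 1) ≈ 1# → C₁ (Backward.ψ y^[q+1]≈1 y≉1)
    ψ-condition₁ {y} y^[q+1]≈1 y≉1 y^[K+1]≈1 = begin
      ψ ^ K + ψ          ≈⟨ +-congʳ (trans (ψ-twist k y^[K+1]≈1) (trans (sym ψ^q≈yψ) (conjugate ψ∈𝒯₁))) ⟩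
      ψ + 1# + ψ         ≈⟨ trans (+-comm _ ψ) (x+[x+1] ψ) ⟩
      1#                 ∎
      where open Backward y^[q+1]≈1 y≉1

    module Z₀ = Correspondence (K ℕ.∸ 1) C₀ (λ g → (g ^ K + g) ≟ 0#) C-resp φ-root₀ ψ-condition₀
    module Z₁ = Correspondence (K ℕ.+ 1) C₁ (λ g → (g ^ K + g) ≟ 1#) C-resp φ-root₁ ψ-condition₁

lemma1 : (m k : ℕ) → 1 ≤ m → 1 ≤ k → (F : GF2^ (2 ℕ.* m)) →
  let open GF2^ F
      open FieldDefs F
      q = 2 ℕ.^ m
      Tr = λ (X : Carrier) → X + X ^ q
      T1 = λ (X : Carrier) → X + X ^ q ≈ 1#
      Z0 = λ (g : Carrier) → T1 g × g ^ (2 ℕ.^ k) + g ≈ 0#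
      Z1 = λ (g : Carrier) → T1 g × g ^ (2 ℕ.^ k) + g ≈ 1#
      inP = λ (y : Carrier) → ∃ λ X → ¬ (X ≈ 0#) × X ^ (q ∸ 1) ≈ y
      a = 2 ℕ.^ k ℕ.+ 1
  in
  -- (i), (ii), (iv), (vi) for every g ∈ 𝒯₁
  (∀ g → T1 g →
      -- (i)
      (Tr (g ^ a) ≈ g ^ (2 ℕ.^ k) + g + 1#)
      -- (ii)
    × (g ^ a ≈ Tr (g ^ a) * g + Tr (g ^ 3) + 1#)
      -- (iv), with d = gcd(m,k) and t = n/d
    × (∀ t → t ℕ.* gcd m k ≡ 2 ℕ.* m →
          (gcd a (q ℕ.+ 1) ≡ 1 → relTrace (gcd m k) t (g ^ a) ≈ 1#)
        × (¬ (gcd a (q ℕ.+ 1) ≡ 1) → relTrace (gcd m k) t (g ^ a) ≈ 0#))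
    × ((m ℕ.+ k) % 2 ≡ 1 → relTrace 1 (2 ℕ.* m) (g ^ a) ≈ 1#)
    × ((m ℕ.+ k) % 2 ≡ 0 → relTrace 1 (2 ℕ.* m) (g ^ a) ≈ 0#)
      -- (vi)
    × (gcd k (2 ℕ.* m) ≡ 1 →
          (Tr (g ^ a) ≈ 0# → (m % 2 ≡ 1 × g ^ 4 ≈ g × ¬ (g ^ 2 ≈ g)))
        × ((m % 2 ≡ 1 × g ^ 4 ≈ g × ¬ (g ^ 2 ≈ g)) → Tr (g ^ a) ≈ 0#)))
  -- (iii)
  × (∀ d e u v → 1 ≤ d → 1 ≤ e → IsNu2 d u → IsNu2 e v →
        ((1 < gcd (2 ℕ.^ d ∸ 1) (2 ℕ.^ e ℕ.+ 1) → v < u)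
          × (v < u → 1 < gcd (2 ℕ.^ d ∸ 1) (2 ℕ.^ e ℕ.+ 1)))
      × ((1 < gcd (2 ℕ.^ d ℕ.+ 1) (2 ℕ.^ e ℕ.+ 1) → u ≡ v)
          × (u ≡ v → 1 < gcd (2 ℕ.^ d ℕ.+ 1) (2 ℕ.^ e ℕ.+ 1)))
      × (gcd (2 ℕ.^ d ∸ 1) (2 ℕ.^ e ℕ.+ 1) ≡ 1
          ⊎ gcd (2 ℕ.^ d ℕ.+ 1) (2 ℕ.^ e ℕ.+ 1) ≡ 1))
  -- (v)
  × (∀ y → (((∃ λ g → Z0 g × g ^ (q ∸ 1) ≈ y) ⊎ y ≈ 1#)
              → inP y × y ^ gcd (2 ℕ.^ k ∸ 1) (q ℕ.+ 1) ≈ 1#)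
         × ((inP y × y ^ gcd (2 ℕ.^ k ∸ 1) (q ℕ.+ 1) ≈ 1#)
              → ((∃ λ g → Z0 g × g ^ (q ∸ 1) ≈ y) ⊎ y ≈ 1#)))
  × (∀ y → (((∃ λ g → Z1 g × g ^ (q ∸ 1) ≈ y) ⊎ y ≈ 1#)
              → inP y × y ^ gcd a (q ℕ.+ 1) ≈ 1#)
         × ((inP y × y ^ gcd a (q ℕ.+ 1) ≈ 1#)
              → ((∃ λ g → Z1 g × g ^ (q ∸ 1) ≈ y) ⊎ y ≈ 1#)))
  × (count Z0 (λ g → ((g + g ^ q) ≟ 1#) ×-dec ((g ^ (2 ℕ.^ k) + g) ≟ 0#))
       ≡ gcd (2 ℕ.^ k ∸ 1) (q ℕ.+ 1) ∸ 1)
  × (count Z1 (λ g → ((g + g ^ q) ≟ 1#) ×-dec ((g ^ (2 ℕ.^ k) + g) ≟ 1#))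
       ≡ gcd a (q ℕ.+ 1) ∸ 1)
lemma1 m k 1≤m 1≤k F =
    (λ g g∈𝒯₁ →
        trace-power g∈𝒯₁ k
      , power-via-traces g∈𝒯₁ k
      , PartIV.over-gcd F m k 1≤m 1≤k g∈𝒯₁
      , PartIV.absolute-odd F m k 1≤m 1≤k g∈𝒯₁
      , PartIV.absolute-even F m k 1≤m 1≤k g∈𝒯₁
      , λ k⊥2m → PartVI.trace-zero⇒ F m k g∈𝒯₁ k⊥2m , PartVI.⇒trace-zero F m k g∈𝒯₁ k⊥2m)
  , PowersOfTwo.part-iii
  , Z₀.image
  , Z₁.image
  , Z₀.count-Z
  , Z₁.count-Z
  where
  open TraceOne F m using (trace-power; power-via-traces)
  open UnitCircle.Conditions m 1≤m F k using (module Z₀; module Z₁)
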